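{- Let $q$ be a prime and let $I$ be the indicator function of $M^c(q)$, i.e. $I(n)=1$ if $n \in M^c(q)$ and $I(n)=0$ otherwise, for integers $n\ge 0$. Then \[ 1-d(q) = \prod_{p \text{ prime}} \left[ \left(1 - \frac{1}{p}\right) \sum_{m=0} ^{\infty} \frac{I(p^m)}{p^m} \right]. \]
   Context: Tower factorization: the tower factorization of $1$ is $1$; if $n>1$ has prime factorization $n=p_1^{e_1}\cdots p_k^{e_k}$, its tower factorization is $\prod_{i=1}^k p_i^{(f_i)}$ where $f_i$ is the tower factorization of $e_i$ (recursively). A prime $q$ is contained in the tower factorization of $n$ if $q$ appears as one of the primes at any level of this recursive representation. For a prime $q$, $M(q)$ is the set of positive integers whose tower factorization contains $q$ (with $1\notin M(q)$, $0\notin M(q)$); $M^c(q) := \{z \in \{0,1,2,\ldots\} : z \notin M(q)\}$. $d(q) := \lim_{N\to\infty} |M(q)\cap\{1,\ldots,N\}|/N$ (this limit exists). -}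

module Defs where

open import Data.Nat as ℕ using (ℕ; zero; suc; _^_)
open import Data.Nat.Properties using (m^n≢0)
open import Data.Nat.Divisibility using (_∣_)
open import Data.Nat.Primality using (Prime; prime?)
open import Data.Integer using (+_)
open import Data.Rational using (ℚ; _/_; 0ℚ; 1ℚ; _+_; _*_; _-_)
open import Relation.Nullary using (¬_; Dec; does)
open import Relation.Binary.PropositionalEquality using (_≢_)
open import Data.Bool using (if_then_else_)

-- InTower q n : the prime q is contained in the tower factorization of n.
-- n ≠ 0 (so 0 ∉ M(q)); 1 has no prime factors, so 1 ∉ M(q).
data InTower (q : ℕ) : ℕ → Set where
  base : ∀ {n} → n ≢ 0 → Prime q → q ∣ n → InTower q n
  expo : ∀ {n p e} → n ≢ 0 → Prime p → p ^ e ∣ n → ¬ (p ^ suc e ∣ n) →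
         InTower q e → InTower q n

Decider : ℕ → Set
Decider q = (n : ℕ) → Dec (InTower q n)

countM : ∀ {q} → Decider q → ℕ → ℕ
countM dec zero = 0
countM dec (suc N) = (if does (dec (suc N)) then 1 else 0) ℕ.+ countM dec N

complDensity : ∀ {q} → Decider q → ℕ → ℚ
complDensity dec N = 1ℚ - (+ countM dec (suc N)) / suc N

seriesTerm : ∀ {q} → Decider q → (k : ℕ) → ℕ → ℚ
seriesTerm dec k m =
  if does (dec (suc k ^ m)) then 0ℚ else (+ 1 / (suc k ^ m)) {{m^n≢0 (suc k) m}}

seriesPart : ∀ {q} → Decider q → (k : ℕ) → ℕ → ℚ
seriesPart dec k zero = seriesTerm dec k zero
seriesPart dec k (suc M) = seriesPart dec k M + seriesTerm dec k (suc M)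

factor : ∀ {q} → Decider q → ℕ → (k : ℕ) → ℚ
factor dec M k =
  if does (prime? (suc k)) then (1ℚ - (+ 1 / suc k)) * seriesPart dec k M else 1ℚ

partialProd : ∀ {q} → Decider q → ℕ → ℕ → ℚ
partialProd dec zero M = 1ℚ
partialProd dec (suc P) M = factor dec M P * partialProd dec P M

{-# OPTIONS --safe #-}
-- Membership in M(q) is local: n ∈ M(q) iff p^v ∈ M(q) for some exact prime power p^v ∥ n.
-- So the truncated condition "v_p(n) ≤ M and p^(v_p(n)) ∉ M(q) for every prime p ≤ P" is
-- periodic modulo D = ∏_{p ≤ P} p^(M+1), and by the Chinese remainder theorem it has
-- ∏_{p ≤ P} (p − 1) ∑_{m ≤ M} p^(M−m) I(p^m) solutions per period; divided by D this is the
-- partial product.  The truncated condition agrees with n ∉ M(q) unless p^(M₁+1) ∣ n for a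
-- prime p ≤ P₁ or k² ∣ n for some k > P₁ (otherwise the primes above P₁ divide n at most once,
-- and they differ from q).  Those exceptional n have density at most (P₁+1)/2^(M₁+1) + 1/P₁.
module Submission where

open import Defs
open import Data.Nat using (ℕ; _≤_)
open import Data.Nat.Primality using (Prime)
open import Data.Product using (_×_; ∃-syntax)
open import Data.Rational using (ℚ; Positive; ∣_∣; _-_) renaming (_≤_ to _≤ℚ_)

open import Data.Bool using (Bool; true; false; _∧_; _∨_; not; T; if_then_else_)
open import Data.Bool.Properties using (T-∧; T-∨)
open import Data.Empty using (⊥; ⊥-elim)
open import Data.Fin using (Fin; toℕ; fromℕ<; punchOut)
open import Data.Fin.Permutation using (Permutation; permutation)
open import Data.Fin.Properties
  using (toℕ-fromℕ<; toℕ-injective; toℕ<n; any?; injective⇒≤; punchOut-injective)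
  renaming (_≟_ to _≟ᶠ_)
open import Data.Integer as ℤ using (+0; +[1+_]; _⊖_)
import Data.Integer.Properties as ℤ
-- Renamed: next to ℚ's ∣_∣ and _-_, the expression ∣ x - y ∣ would be ambiguous.
open import Data.Nat.Base
  using (zero; suc; _+_; _*_; _∸_; _^_; _⊔_; _<_; z≤n; s≤s; pred; NonZero; _/_; _%_;
         nonTrivial⇒n>1; ≢-nonZero; ≢-nonZero⁻¹; >-nonZero)
  renaming (∣_-_∣ to dist)
open import Data.Nat.Coprimality using (Coprime; coprime-divisor; 1-coprimeTo)
open import Data.Nat.Divisibility
  using (_∣_; divides; _∣?_; ∣-refl; ∣-trans; ∣⇒≤; >⇒∤; ∣1⇒≡1; 1∣_; m∣m*n;
         ∣m∣n⇒∣m+n; ∣m+n∣m⇒∣n; *-monoˡ-∣; *-cancelʳ-∣)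
open import Data.Nat.DivMod
  using (m≡m%n+[m/n]*n; m%n<n; m*n/n≡m; n/n≡1; m/n*n≤m; /-monoˡ-≤; /-monoʳ-≤)
open import Data.Nat.Induction using (<-rec)
open import Data.Nat.Primality using (prime?; prime⇒nonTrivial; prime⇒irreducible; euclidsLemma)
open import Data.Nat.Properties
open import Data.Nat.Tactic.RingSolver using (solve-∀)
open import Data.Product using (∃; _,_; proj₁; proj₂)
open import Data.Rational as ℚ using (mkℚ; toℚᵘ; 1ℚ)
import Data.Rational.Properties as ℚ
open import Data.Rational.Unnormalised as ℚᵘ using (mkℚᵘ; *≡*; *≤*)
import Data.Rational.Unnormalised.Properties as ℚᵘ
open import Data.Sum using (inj₁; inj₂)
open import Function using (_∘_)
open import Function.Bundles using (module Equivalence)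
open import Relation.Binary.Definitions using (tri<; tri≈; tri>)
open import Relation.Binary.PropositionalEquality
open import Relation.Nullary using (Dec; does; yes; no; ¬_; ¬?; _×-dec_)
open import Relation.Nullary.Decidable using (map′; dec-true; dec-false)

open Equivalence using (to; from)
import Algebra.Properties.CommutativeMonoid.Sum +-0-commutativeMonoid as FinSum
open import Algebra.Properties.CommutativeSemigroup +-commutativeSemigroup
  using () renaming (interchange to +-interchange)
open import Algebra.Properties.Group ℚ.+-0-group using (//-rightDividesʳ)

fromDoes : ∀ {A : Set} (a? : Dec A) → T (does a?) → A
fromDoes (yes a) _ = a

toDoes : ∀ {A : Set} (a? : Dec A) → A → T (does a?)
toDoes (yes _) _ = _
toDoes (no ¬a) a = ¬a a

fromNotDoes : ∀ {A : Set} (a? : Dec A) → T (not (does a?)) → ¬ A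
fromNotDoes (no ¬a) _ = ¬a

toNotDoes : ∀ {A : Set} (a? : Dec A) → ¬ A → T (not (does a?))
toNotDoes (yes a) ¬a = ¬a a
toNotDoes (no _) _ = _

T-injective : ∀ {x y} → (T x → T y) → (T y → T x) → x ≡ y
T-injective {true} {true} _ _ = refl
T-injective {true} {false} x⇒y _ = ⊥-elim (x⇒y _)
T-injective {false} {true} _ y⇒x = ⊥-elim (y⇒x _)
T-injective {false} {false} _ _ = refl

𝟙 : Bool → ℕ
𝟙 b = if b then 1 else 0

𝟙≤1 : ∀ b → 𝟙 b ≤ 1
𝟙≤1 true = ≤-refl
𝟙≤1 false = z≤n

∑< : ℕ → (ℕ → ℕ) → ℕ
∑< zero f = 0
∑< (suc n) f = f 0 + ∑< n (λ i → f (suc i))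

syntax ∑< n (λ i → e) = ∑[ i < n ] e

count : (ℕ → Bool) → ℕ → ℕ
count f n = ∑[ i < n ] 𝟙 (f i)

∑<-cong : ∀ n {f g : ℕ → ℕ} → (∀ i → i < n → f i ≡ g i) → ∑< n f ≡ ∑< n g
∑<-cong zero h = refl
∑<-cong (suc n) h = cong₂ _+_ (h 0 (s≤s z≤n)) (∑<-cong n (λ i i<n → h (suc i) (s≤s i<n)))

∑<-mono-≤ : ∀ n {f g : ℕ → ℕ} → (∀ i → i < n → f i ≤ g i) → ∑< n f ≤ ∑< n g
∑<-mono-≤ zero h = z≤n
∑<-mono-≤ (suc n) h = +-mono-≤ (h 0 (s≤s z≤n)) (∑<-mono-≤ n (λ i i<n → h (suc i) (s≤s i<n)))

∑<-distrib-+ : ∀ n (f g : ℕ → ℕ) → ∑[ i < n ] (f i + g i) ≡ ∑< n f + ∑< n g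
∑<-distrib-+ zero f g = refl
∑<-distrib-+ (suc n) f g = begin
  f 0 + g 0 + ∑[ i < n ] (f (suc i) + g (suc i))
    ≡⟨ cong (f 0 + g 0 +_) (∑<-distrib-+ n (λ i → f (suc i)) (λ i → g (suc i))) ⟩
  f 0 + g 0 + (∑[ i < n ] f (suc i) + ∑[ i < n ] g (suc i))
    ≡⟨ +-interchange (f 0) (g 0) _ _ ⟩
  f 0 + ∑[ i < n ] f (suc i) + (g 0 + ∑[ i < n ] g (suc i)) ∎
  where open ≡-Reasoning

*-distribˡ-∑< : ∀ k n (f : ℕ → ℕ) → k * ∑< n f ≡ ∑[ i < n ] (k * f i)
*-distribˡ-∑< k zero f = *-zeroʳ k
*-distribˡ-∑< k (suc n) f =
  trans (*-distribˡ-+ k (f 0) _) (cong (k * f 0 +_) (*-distribˡ-∑< k n (λ i → f (suc i))))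

*-distribʳ-∑< : ∀ k n (f : ℕ → ℕ) → ∑< n f * k ≡ ∑[ i < n ] (f i * k)
*-distribʳ-∑< k n f =
  trans (*-comm _ k) (trans (*-distribˡ-∑< k n f) (∑<-cong n (λ i _ → *-comm k (f i))))

∑<-const : ∀ n c → ∑[ i < n ] c ≡ n * c
∑<-const zero c = refl
∑<-const (suc n) c = cong (c +_) (∑<-const n c)

∑<-split : ∀ m n (f : ℕ → ℕ) → ∑< (m + n) f ≡ ∑< m f + ∑[ i < n ] f (m + i)
∑<-split zero n f = refl
∑<-split (suc m) n f =
  trans (cong (f 0 +_) (∑<-split m n (λ i → f (suc i)))) (sym (+-assoc (f 0) _ _))

∑<-suc : ∀ n (f : ℕ → ℕ) → ∑< (suc n) f ≡ ∑< n f + f n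
∑<-suc n f = begin
  ∑< (suc n) f          ≡⟨ cong (λ m → ∑< m f) (+-comm 1 n) ⟩
  ∑< (n + 1) f          ≡⟨ ∑<-split n 1 f ⟩
  ∑< n f + (f (n + 0) + 0) ≡⟨ cong (∑< n f +_) (trans (+-identityʳ _) (cong f (+-identityʳ n))) ⟩
  ∑< n f + f n          ∎
  where open ≡-Reasoning

∑<-comm : ∀ a b (F : ℕ → ℕ → ℕ) → ∑[ t < b ] ∑[ i < a ] F t i ≡ ∑[ i < a ] ∑[ t < b ] F t i
∑<-comm a zero F = sym (trans (∑<-cong a (λ _ _ → refl)) (trans (∑<-const a 0) (*-zeroʳ a)))
∑<-comm a (suc b) F = begin
  ∑< a (F 0) + ∑[ t < b ] ∑[ i < a ] F (suc t) i
    ≡⟨ cong (∑< a (F 0) +_) (∑<-comm a b (λ t → F (suc t))) ⟩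
  ∑< a (F 0) + ∑[ i < a ] ∑[ t < b ] F (suc t) i
    ≡⟨ sym (∑<-distrib-+ a (F 0) (λ i → ∑[ t < b ] F (suc t) i)) ⟩
  ∑[ i < a ] (F 0 i + ∑[ t < b ] F (suc t) i) ∎
  where open ≡-Reasoning

∑<-blocks : ∀ a b (f : ℕ → ℕ) → ∑< (b * a) f ≡ ∑[ t < b ] ∑[ i < a ] f (t * a + i)
∑<-blocks a zero f = refl
∑<-blocks a (suc b) f = trans (∑<-split a (b * a) f)
  (cong (∑< a f +_) (trans (∑<-blocks a b (λ i → f (a + i)))
    (∑<-cong b (λ t _ → ∑<-cong a (λ i _ → cong f (sym (+-assoc a (t * a) i)))))))

dist-∑<-≤ : ∀ n (f g : ℕ → ℕ) → dist (∑< n f) (∑< n g) ≤ ∑[ i < n ] dist (f i) (g i)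
dist-∑<-≤ zero f g = z≤n
dist-∑<-≤ (suc n) f g = begin
  dist (f 0 + ∑[ i < n ] f (suc i)) (g 0 + ∑[ i < n ] g (suc i))
    ≤⟨ dist-+-≤ (f 0) (g 0) _ _ ⟩
  dist (f 0) (g 0) + dist (∑[ i < n ] f (suc i)) (∑[ i < n ] g (suc i))
    ≤⟨ +-monoʳ-≤ (dist (f 0) (g 0)) (dist-∑<-≤ n (λ i → f (suc i)) (λ i → g (suc i))) ⟩
  dist (f 0) (g 0) + ∑[ i < n ] dist (f (suc i)) (g (suc i)) ∎
  where
  open ≤-Reasoning
  dist-+-≤ : ∀ a b c d → dist (a + c) (b + d) ≤ dist a b + dist c d
  dist-+-≤ a b c d = begin
    dist (a + c) (b + d)                  ≤⟨ ∣-∣-triangle (a + c) (b + c) (b + d) ⟩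
    dist (a + c) (b + c) + dist (b + c) (b + d)
      ≡⟨ cong₂ _+_ (trans (cong₂ dist (+-comm a c) (+-comm b c)) (∣m+n-m+o∣≡∣n-o∣ c a b))
                   (∣m+n-m+o∣≡∣n-o∣ b c d) ⟩
    dist a b + dist c d                   ∎

count≤ : ∀ f n → count f n ≤ n
count≤ f zero = z≤n
count≤ f (suc n) = +-mono-≤ (𝟙≤1 (f 0)) (count≤ (λ i → f (suc i)) n)

𝟙-∧ : ∀ x y → 𝟙 (x ∧ y) ≡ 𝟙 x * 𝟙 y
𝟙-∧ true y = sym (+-identityʳ _)
𝟙-∧ false y = refl

count-∧-const : ∀ (f : ℕ → Bool) c X → count (λ n → f n ∧ c) X ≡ count f X * 𝟙 c
count-∧-const f c X = trans (∑<-cong X (λ n _ → 𝟙-∧ (f n) c)) (sym (*-distribʳ-∑< (𝟙 c) X _))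

count-∧-not : ∀ (f g : ℕ → Bool) X → (∀ n → T (g n) → T (f n)) →
              count (λ n → f n ∧ not (g n)) X + count g X ≡ count f X
count-∧-not f g X g⇒f = trans (sym (∑<-distrib-+ X _ _)) (∑<-cong X (λ n _ → 𝟙-split (f n) (g n) (g⇒f n)))
  where
  𝟙-split : ∀ x y → (T y → T x) → 𝟙 (x ∧ not y) + 𝟙 y ≡ 𝟙 x
  𝟙-split true true _ = refl
  𝟙-split true false _ = refl
  𝟙-split false true y⇒x = ⊥-elim (y⇒x _)
  𝟙-split false false _ = refl

count-∨-disjoint : ∀ (f g : ℕ → Bool) X → (∀ n → T (f n) → T (g n) → ⊥) →
                   count (λ n → f n ∨ g n) X ≡ count f X + count g X
count-∨-disjoint f g X disjoint =
  trans (∑<-cong X (λ n _ → 𝟙-∨ (f n) (g n) (disjoint n))) (∑<-distrib-+ X _ _)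
  where
  𝟙-∨ : ∀ x y → (T x → T y → ⊥) → 𝟙 (x ∨ y) ≡ 𝟙 x + 𝟙 y
  𝟙-∨ true true both = ⊥-elim (both _ _)
  𝟙-∨ true false _ = refl
  𝟙-∨ false y _ = refl

count-∨-≤ : ∀ (f g : ℕ → Bool) X → count (λ n → f n ∨ g n) X ≤ count f X + count g X
count-∨-≤ f g X = ≤-trans (∑<-mono-≤ X (λ n _ → 𝟙-∨-≤ (f n) (g n))) (≤-reflexive (∑<-distrib-+ X _ _))
  where
  𝟙-∨-≤ : ∀ x y → 𝟙 (x ∨ y) ≤ 𝟙 x + 𝟙 y
  𝟙-∨-≤ true y = s≤s z≤n
  𝟙-∨-≤ false y = ≤-refl

any< : ℕ → (ℕ → Bool) → Bool
any< zero f = false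
any< (suc K) f = any< K f ∨ f K

any<⁺ : ∀ {K k} (f : ℕ → Bool) → k < K → T (f k) → T (any< K f)
any<⁺ {suc K} {k} f k<1+K fk with m≤n⇒m<n∨m≡n k<1+K
... | inj₁ k<K = from T-∨ (inj₁ (any<⁺ f (≤-pred k<K) fk))
... | inj₂ refl = from T-∨ (inj₂ fk)

any<⁻ : ∀ {K} (f : ℕ → Bool) → T (any< K f) → ∃ λ k → k < K × T (f k)
any<⁻ {suc K} f hit with to T-∨ hit
... | inj₁ earlier = let k , k<K , fk = any<⁻ f earlier in k , m≤n⇒m≤1+n k<K , fk
... | inj₂ fK = K , ≤-refl , fK

any<-cong : ∀ K {f g : ℕ → Bool} → (∀ k → k < K → f k ≡ g k) → any< K f ≡ any< K g
any<-cong zero _ = refl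
any<-cong (suc K) f≡g = cong₂ _∨_ (any<-cong K (λ k k<K → f≡g k (m≤n⇒m≤1+n k<K))) (f≡g K ≤-refl)

count-any<-≤ : ∀ K (h : ℕ → ℕ → Bool) X →
               count (λ n → any< K (λ k → h k n)) X ≤ ∑[ k < K ] count (h k) X
count-any<-≤ zero h X = ≤-reflexive (trans (∑<-const X 0) (*-zeroʳ X))
count-any<-≤ (suc K) h X = begin
  count (λ n → any< K (λ k → h k n) ∨ h K n) X      ≤⟨ count-∨-≤ _ (h K) X ⟩
  count (λ n → any< K (λ k → h k n)) X + count (h K) X ≤⟨ +-monoˡ-≤ _ (count-any<-≤ K h X) ⟩
  ∑[ k < K ] count (h k) X + count (h K) X           ≡⟨ sym (∑<-suc K _) ⟩
  ∑[ k < suc K ] count (h k) X                       ∎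
  where open ≤-Reasoning

dist-count-≤ : ∀ (f g bad : ℕ → Bool) X → (∀ n → n < X → ¬ T (bad n) → f n ≡ g n) →
               dist (count f X) (count g X) ≤ count bad X
dist-count-≤ f g bad X agree = ≤-trans (dist-∑<-≤ X _ _)
  (∑<-mono-≤ X (λ n n<X → dist-𝟙 (f n) (g n) (bad n) (agree n n<X)))
  where
  dist-𝟙 : ∀ x y b → (¬ T b → x ≡ y) → dist (𝟙 x) (𝟙 y) ≤ 𝟙 b
  dist-𝟙 x y true _ = ≤-trans (∣m-n∣≤m⊔n (𝟙 x) (𝟙 y)) (⊔-lub (𝟙≤1 x) (𝟙≤1 y))
  dist-𝟙 x y false x≡y = ≤-reflexive (trans (cong (λ z → dist (𝟙 z) (𝟙 y)) (x≡y λ ())) (∣n-n∣≡0 (𝟙 y)))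

Periodic : (ℕ → Bool) → ℕ → Set
Periodic f a = ∀ n → f (n + a) ≡ f n

module _ {f : ℕ → Bool} {a : ℕ} (f-per : Periodic f a) where

  periodic-+* : ∀ k n → f (n + k * a) ≡ f n
  periodic-+* zero n = cong f (+-identityʳ n)
  periodic-+* (suc k) n =
    trans (cong f (shuffle n a (k * a))) (trans (f-per (n + k * a)) (periodic-+* k n))
    where
    shuffle : ∀ x y z → x + (y + z) ≡ x + z + y
    shuffle = solve-∀

  periodic-*ˡ : ∀ k → Periodic f (k * a)
  periodic-*ˡ = periodic-+*

  periodic-*ʳ : ∀ k → Periodic f (a * k)
  periodic-*ʳ k = subst (Periodic f) (*-comm k a) (periodic-*ˡ k)

  periodic-% : .{{_ : NonZero a}} → ∀ n → f n ≡ f (n % a)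
  periodic-% n = trans (cong f (m≡m%n+[m/n]*n n a)) (periodic-+* (n / a) (n % a))

  count-periodic : ∀ k r → count f (k * a + r) ≡ k * count f a + count f r
  count-periodic zero r = refl
  count-periodic (suc k) r = begin
    count f (a + k * a + r)               ≡⟨ cong (count f) (+-assoc a (k * a) r) ⟩
    count f (a + (k * a + r))             ≡⟨ ∑<-split a (k * a + r) _ ⟩
    count f a + ∑[ i < k * a + r ] 𝟙 (f (a + i))
      ≡⟨ cong (count f a +_) (∑<-cong (k * a + r) (λ i _ → cong 𝟙 (trans (cong f (+-comm a i)) (f-per i)))) ⟩
    count f a + count f (k * a + r)       ≡⟨ cong (count f a +_) (count-periodic k r) ⟩
    count f a + (k * count f a + count f r) ≡⟨ sym (+-assoc (count f a) _ _) ⟩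
    count f a + k * count f a + count f r ∎
    where open ≡-Reasoning

  count-period-multiple : ∀ k → count f (k * a) ≡ k * count f a
  count-period-multiple k =
    trans (cong (count f) (sym (+-identityʳ (k * a)))) (trans (count-periodic k 0) (+-identityʳ _))

  dist-count-periodic : .{{_ : NonZero a}} → ∀ N → dist (count f N * a) (count f a * N) ≤ a * a
  dist-count-periodic N = begin
    dist (count f N * a) (count f a * N)
      ≡⟨ cong₂ dist (trans (cong (λ m → count f m * a) N≡) (cong (_* a) (count-periodic k r)))
                    (cong (count f a *_) N≡) ⟩
    dist ((k * count f a + count f r) * a) (count f a * (k * a + r))
      ≡⟨ cong₂ dist (expand-left k (count f a) (count f r) a) (expand-right k (count f a) r a) ⟩
    dist (k * count f a * a + count f r * a) (k * count f a * a + count f a * r)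
      ≡⟨ ∣m+n-m+o∣≡∣n-o∣ (k * count f a * a) _ _ ⟩
    dist (count f r * a) (count f a * r)
      ≤⟨ ∣m-n∣≤m⊔n (count f r * a) (count f a * r) ⟩
    count f r * a ⊔ count f a * r
      ≤⟨ ⊔-lub (*-monoˡ-≤ a (≤-trans (count≤ f r) r≤a)) (*-mono-≤ (count≤ f a) r≤a) ⟩
    a * a ∎
    where
    open ≤-Reasoning
    k = N / a
    r = N % a
    N≡ : N ≡ k * a + r
    N≡ = trans (m≡m%n+[m/n]*n N a) (+-comm r (k * a))
    r≤a : r ≤ a
    r≤a = <⇒≤ (m%n<n N a)
    expand-left : ∀ k c d a → (k * c + d) * a ≡ k * c * a + d * a
    expand-left = solve-∀
    expand-right : ∀ k c r a → c * (k * a + r) ≡ k * c * a + c * r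
    expand-right = solve-∀

periodic-∧ : ∀ {f g a} → Periodic f a → Periodic g a → Periodic (λ n → f n ∧ g n) a
periodic-∧ f-per g-per n = cong₂ _∧_ (f-per n) (g-per n)

injective⇒surjective : ∀ {n} {σ : Fin n → Fin n} → (∀ {x y} → σ x ≡ σ y → x ≡ y) →
                        ∀ y → ∃ λ x → σ x ≡ y
injective⇒surjective {suc n} {σ} σ-inj y with any? (λ x → σ x ≟ᶠ y)
... | yes hit = hit
... | no miss = ⊥-elim (<⇒≱ ≤-refl (injective⇒≤ missY-inj))
  where
  missY : Fin (suc n) → Fin n
  missY x = punchOut {i = y} {j = σ x} (λ eq → miss (x , sym eq))
  missY-inj : ∀ {x x′} → missY x ≡ missY x′ → x ≡ x′
  missY-inj {x} {x′} eq =
    σ-inj (punchOut-injective (λ e → miss (x , sym e)) (λ e → miss (x′ , sym e)) eq)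

∑<-permute : ∀ b (σ : ℕ → ℕ) → (∀ t → t < b → σ t < b) →
             (∀ t u → t < b → u < b → σ t ≡ σ u → t ≡ u) →
             ∀ G → ∑[ t < b ] G (σ t) ≡ ∑< b G
∑<-permute b σ σ<b σ-inj G = begin
  ∑[ t < b ] G (σ t)                      ≡⟨ ∑<-as-sum b _ ⟩
  FinSum.sum {b} (λ t → G (σ (toℕ t)))    ≡⟨ FinSum.sum-cong-≗ {b} (λ t → cong G (sym (σᶠ-toℕ t))) ⟩
  FinSum.sum {b} (λ t → G (toℕ (σᶠ t)))   ≡⟨ sym (FinSum.sum-permute (λ t → G (toℕ t)) π) ⟩
  FinSum.sum {b} (λ t → G (toℕ t))        ≡⟨ sym (∑<-as-sum b G) ⟩
  ∑< b G                                  ∎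
  where
  open ≡-Reasoning
  ∑<-as-sum : ∀ n (f : ℕ → ℕ) → ∑< n f ≡ FinSum.sum (λ (i : Fin n) → f (toℕ i))
  ∑<-as-sum zero f = refl
  ∑<-as-sum (suc n) f = cong (f 0 +_) (∑<-as-sum n (λ i → f (suc i)))
  σᶠ : Fin b → Fin b
  σᶠ t = fromℕ< (σ<b (toℕ t) (toℕ<n t))
  σᶠ-toℕ : ∀ t → toℕ (σᶠ t) ≡ σ (toℕ t)
  σᶠ-toℕ t = toℕ-fromℕ< (σ<b (toℕ t) (toℕ<n t))
  σᶠ-inj : ∀ {t u} → σᶠ t ≡ σᶠ u → t ≡ u
  σᶠ-inj {t} {u} eq = toℕ-injective (σ-inj _ _ (toℕ<n t) (toℕ<n u)
    (trans (sym (σᶠ-toℕ t)) (trans (cong toℕ eq) (σᶠ-toℕ u))))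
  σᶠ⁻¹ : Fin b → Fin b
  σᶠ⁻¹ y = proj₁ (injective⇒surjective σᶠ-inj y)
  π : Permutation b b
  π = permutation σᶠ σᶠ⁻¹ (λ y → proj₂ (injective⇒surjective σᶠ-inj y))
        (λ x → σᶠ-inj (proj₂ (injective⇒surjective σᶠ-inj (σᶠ x))))

[m+n]%d≡m%d⇒d∣n : ∀ m n d .{{_ : NonZero d}} → (m + n) % d ≡ m % d → d ∣ n
[m+n]%d≡m%d⇒d∣n m n d eq = divides ((m + n) / d ∸ m / d) (begin
  n                                         ≡⟨ sym (m+n∸m≡n m n) ⟩
  m + n ∸ m                                 ≡⟨ cong₂ _∸_ m+n≡ (m≡m%n+[m/n]*n m d) ⟩
  (m % d + (m + n) / d * d) ∸ (m % d + m / d * d) ≡⟨ [m+n]∸[m+o]≡n∸o (m % d) _ _ ⟩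
  (m + n) / d * d ∸ m / d * d               ≡⟨ sym (*-distribʳ-∸ d ((m + n) / d) (m / d)) ⟩
  ((m + n) / d ∸ m / d) * d                 ∎)
  where
  open ≡-Reasoning
  m+n≡ : m + n ≡ m % d + (m + n) / d * d
  m+n≡ = trans (m≡m%n+[m/n]*n (m + n) d) (cong (_+ (m + n) / d * d) eq)

module _ (a b i : ℕ) .{{_ : NonZero b}} (b⊥a : Coprime b a) where

  affine-%-injective-≤ : ∀ t u → t ≤ u → u < b → (t * a + i) % b ≡ (u * a + i) % b → t ≡ u
  affine-%-injective-≤ t u t≤u u<b eq with u ∸ t | m∸n+n≡m t≤u
  ... | zero  | u≡t = u≡t
  ... | suc d | u≡ = ⊥-elim (>⇒∤ (≤-<-trans (subst (suc d ≤_) u≡ (m≤m+n (suc d) t)) u<b)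
                              (coprime-divisor b⊥a (subst (b ∣_) (*-comm (suc d) a) b∣da)))
    where
    rearrange : ∀ t d a i → t * a + i + d * a ≡ (t + d) * a + i
    rearrange = solve-∀
    shift : t * a + i + suc d * a ≡ u * a + i
    shift = trans (rearrange t (suc d) a i) (cong (λ x → x * a + i) (trans (+-comm t (suc d)) u≡))
    b∣da : b ∣ suc d * a
    b∣da = [m+n]%d≡m%d⇒d∣n (t * a + i) (suc d * a) b (trans (cong (_% b) shift) (sym eq))

  affine-%-injective : ∀ t u → t < b → u < b → (t * a + i) % b ≡ (u * a + i) % b → t ≡ u
  affine-%-injective t u t<b u<b eq with ≤-total t u
  ... | inj₁ t≤u = affine-%-injective-≤ t u t≤u u<b eq
  ... | inj₂ u≤t = sym (affine-%-injective-≤ u t u≤t t<b (sym eq))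

count-∧-coprime : ∀ {f g : ℕ → Bool} a b .{{_ : NonZero b}} → Periodic f a → Periodic g b →
                  Coprime b a → count (λ n → f n ∧ g n) (b * a) ≡ count f a * count g b
count-∧-coprime {f} {g} a b f-per g-per b⊥a = begin
  count (λ n → f n ∧ g n) (b * a)                          ≡⟨ ∑<-blocks a b _ ⟩
  ∑[ t < b ] ∑[ i < a ] 𝟙 (f (t * a + i) ∧ g (t * a + i))
    ≡⟨ ∑<-cong b (λ t _ → ∑<-cong a (λ i _ → trans (𝟙-∧ (f (t * a + i)) _)
         (cong (λ x → 𝟙 x * 𝟙 (g (t * a + i))) (trans (cong f (+-comm (t * a) i)) (periodic-+* f-per t i))))) ⟩
  ∑[ t < b ] ∑[ i < a ] (𝟙 (f i) * 𝟙 (g (t * a + i)))     ≡⟨ ∑<-comm a b _ ⟩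
  ∑[ i < a ] ∑[ t < b ] (𝟙 (f i) * 𝟙 (g (t * a + i)))
    ≡⟨ ∑<-cong a (λ i _ → trans (sym (*-distribˡ-∑< (𝟙 (f i)) b _)) (cong (𝟙 (f i) *_) (fibre i))) ⟩
  ∑[ i < a ] (𝟙 (f i) * count g b)                        ≡⟨ sym (*-distribʳ-∑< (count g b) a _) ⟩
  count f a * count g b                                   ∎
  where
  open ≡-Reasoning
  -- Since b ⊥ a, t ↦ (t·a + i) mod b permutes [0, b).
  fibre : ∀ i → ∑[ t < b ] 𝟙 (g (t * a + i)) ≡ count g b
  fibre i = trans (∑<-cong b (λ t _ → cong 𝟙 (periodic-% g-per (t * a + i))))
    (∑<-permute b (λ t → (t * a + i) % b) (λ t _ → m%n<n (t * a + i) b)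
      (affine-%-injective a b i b⊥a) (λ n → 𝟙 (g n)))

prime>1 : ∀ {p} → Prime p → 1 < p
prime>1 {p} p-prime = nonTrivial⇒n>1 p {{prime⇒nonTrivial p-prime}}

1<m⇒m^n≢0 : ∀ {m} → 1 < m → ∀ n → m ^ n ≢ 0
1<m⇒m^n≢0 {m} 1<m n = ≢-nonZero⁻¹ (m ^ n) {{m^n≢0 m n {{>-nonZero (<-trans (s≤s z≤n) 1<m)}}}}

m^n∣m^o : ∀ m {n o} → n ≤ o → m ^ n ∣ m ^ o
m^n∣m^o m {n} {o} n≤o = divides (m ^ (o ∸ n))
  (trans (cong (m ^_) (sym (m∸n+n≡m n≤o))) (^-distribˡ-+-* m (o ∸ n) n))

>1⇒∤1 : ∀ {p} → 1 < p → ¬ p ∣ 1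
>1⇒∤1 1<p p∣1 = <⇒≢ 1<p (sym (∣1⇒≡1 p∣1))

n<m^n : ∀ {m} → 1 < m → ∀ n → n < m ^ n
n<m^n 1<m zero = s≤s z≤n
n<m^n {m} 1<m (suc n) = begin-strict
  suc n                 <⟨ s≤s (n<m^n 1<m n) ⟩
  suc (m ^ n)           ≡⟨ +-comm 1 (m ^ n) ⟩
  m ^ n + 1             ≤⟨ +-monoʳ-≤ (m ^ n) (m^n>0 m {{>-nonZero (<-trans (s≤s z≤n) 1<m)}} n) ⟩
  m ^ n + m ^ n         ≡⟨ cong (m ^ n +_) (sym (+-identityʳ (m ^ n))) ⟩
  2 * m ^ n             ≤⟨ *-monoˡ-≤ (m ^ n) 1<m ⟩
  m * m ^ n             ∎
  where open ≤-Reasoning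

prime∣m^n⇒prime∣m : ∀ {r} → Prime r → ∀ m n → r ∣ m ^ n → r ∣ m
prime∣m^n⇒prime∣m r-prime m zero r∣1 = ⊥-elim (>1⇒∤1 (prime>1 r-prime) r∣1)
prime∣m^n⇒prime∣m r-prime m (suc n) r∣mmⁿ with euclidsLemma m (m ^ n) r-prime r∣mmⁿ
... | inj₁ r∣m = r∣m
... | inj₂ r∣mⁿ = prime∣m^n⇒prime∣m r-prime m n r∣mⁿ

prime∣prime⇒≡ : ∀ {r p} → Prime r → Prime p → r ∣ p → r ≡ p
prime∣prime⇒≡ r-prime p-prime r∣p with prime⇒irreducible p-prime r∣p
... | inj₁ r≡1 = ⊥-elim (<⇒≢ (prime>1 r-prime) (sym r≡1))
... | inj₂ r≡p = r≡p

∣-+ʳ-cancel : ∀ {d n D} → d ∣ D → d ∣ n + D → d ∣ n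
∣-+ʳ-cancel {d} {n} {D} d∣D d∣n+D = ∣m+n∣m⇒∣n (subst (d ∣_) (+-comm n D) d∣n+D) d∣D

infix 4 _∣ᵇ_

_∣ᵇ_ : ℕ → ℕ → Bool
d ∣ᵇ n = does (d ∣? n)

module _ (d : ℕ) .{{_ : NonZero d}} where

  private
    multiple : ℕ → Bool
    multiple n = d ∣ᵇ suc n

    multiple-periodic : Periodic multiple d
    multiple-periodic n = T-injective
      (λ d∣n+1+d → toDoes (d ∣? suc n) (∣-+ʳ-cancel ∣-refl (fromDoes (d ∣? suc (n + d)) d∣n+1+d)))
      (λ d∣n+1 → toDoes (d ∣? suc (n + d)) (∣m∣n⇒∣m+n (fromDoes (d ∣? suc n) d∣n+1) ∣-refl))

    no-multiples-below : ∀ {r} → r < d → count multiple r ≡ 0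
    no-multiples-below {r} r<d =
      trans (∑<-cong r (λ n n<r → cong 𝟙 (dec-false (d ∣? suc n) (>⇒∤ (≤-<-trans n<r r<d)))))
            (trans (∑<-const r 0) (*-zeroʳ r))

    one-multiple-per-period : count multiple d ≡ 1
    one-multiple-per-period = begin
      count multiple d                              ≡⟨ cong (count multiple) (sym (suc-pred d)) ⟩
      count multiple (suc (pred d))                 ≡⟨ ∑<-suc (pred d) _ ⟩
      count multiple (pred d) + 𝟙 (multiple (pred d))
        ≡⟨ cong₂ _+_ (no-multiples-below (≤-reflexive (suc-pred d)))
                     (cong 𝟙 (dec-true (d ∣? suc (pred d)) (subst (d ∣_) (sym (suc-pred d)) ∣-refl))) ⟩
      1                                             ∎
      where open ≡-Reasoning

  count-multiples : ∀ X → count (λ n → d ∣ᵇ suc n) X ≡ X / d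
  count-multiples X = begin
    count multiple X                        ≡⟨ cong (count multiple) (trans (m≡m%n+[m/n]*n X d) (+-comm (X % d) _)) ⟩
    count multiple (X / d * d + X % d)      ≡⟨ count-periodic multiple-periodic (X / d) (X % d) ⟩
    X / d * count multiple d + count multiple (X % d)
      ≡⟨ cong₂ (λ a b → X / d * a + b) one-multiple-per-period (no-multiples-below (m%n<n X d)) ⟩
    X / d * 1 + 0                           ≡⟨ trans (+-identityʳ _) (*-identityʳ _) ⟩
    X / d                                   ∎
    where open ≡-Reasoning

prime∤⇒coprime : ∀ {p X} → Prime p → ¬ p ∣ X → Coprime p X
prime∤⇒coprime p-prime p∤X (d∣p , d∣X) with prime⇒irreducible p-prime d∣p
... | inj₁ d≡1 = d≡1
... | inj₂ refl = ⊥-elim (p∤X d∣X)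

coprime-*ˡ : ∀ {a b X} → Coprime a X → Coprime b X → Coprime (a * b) X
coprime-*ˡ {a} a⊥X b⊥X {d} (d∣ab , d∣X) = b⊥X (coprime-divisor d⊥a d∣ab , d∣X)
  where
  d⊥a : Coprime d a
  d⊥a (e∣d , e∣a) = a⊥X (e∣a , ∣-trans e∣d d∣X)

prime∤⇒coprime-^ : ∀ {p X} → Prime p → ¬ p ∣ X → ∀ k → Coprime (p ^ k) X
prime∤⇒coprime-^ p-prime p∤X zero = 1-coprimeTo _
prime∤⇒coprime-^ p-prime p∤X (suc k) =
  coprime-*ˡ (prime∤⇒coprime p-prime p∤X) (prime∤⇒coprime-^ p-prime p∤X k)

isPrimeᵇ : ℕ → Bool
isPrimeᵇ p = does (prime? p)

record Exact (p e n : ℕ) : Set where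
  constructor exact
  field
    power∣ : p ^ e ∣ n
    nextPower∤ : ¬ (p ^ suc e ∣ n)

exact-unique : ∀ {p e f n} → Exact p e n → Exact p f n → e ≡ f
exact-unique {p} {e} {f} (exact pᵉ∣n pᵉ⁺¹∤n) (exact pᶠ∣n pᶠ⁺¹∤n) with <-cmp e f
... | tri< e<f _ _ = ⊥-elim (pᵉ⁺¹∤n (∣-trans (m^n∣m^o p e<f) pᶠ∣n))
... | tri≈ _ e≡f _ = e≡f
... | tri> _ _ f<e = ⊥-elim (pᶠ⁺¹∤n (∣-trans (m^n∣m^o p f<e) pᵉ∣n))

exact-^ : ∀ {p} → 1 < p → ∀ e → Exact p e (p ^ e)
exact-^ {p} 1<p e = exact ∣-refl λ pᵉ⁺¹∣pᵉ →
  <⇒≱ (^-monoʳ-< p 1<p (n<1+n e)) (∣⇒≤ {{≢-nonZero (1<m⇒m^n≢0 1<p e)}} pᵉ⁺¹∣pᵉ)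

exact⇒< : ∀ {p e n} → 1 < p → n ≢ 0 → p ^ e ∣ n → e < n
exact⇒< {p} {e} 1<p n≢0 pᵉ∣n = <-≤-trans (n<m^n 1<p e) (∣⇒≤ {{≢-nonZero n≢0}} pᵉ∣n)

exactExponent : ∀ {p} → 1 < p → ∀ n → n ≢ 0 → ∃ λ e → Exact p e n
exactExponent {p} 1<p = <-rec (λ n → n ≢ 0 → ∃ λ e → Exact p e n) step
  where
  step : ∀ n → (∀ {m} → m < n → m ≢ 0 → ∃ λ e → Exact p e m) → n ≢ 0 → ∃ λ e → Exact p e n
  step n rec n≢0 with p ∣? n
  ... | no p∤n = 0 , exact (1∣ n) λ p∣n → p∤n (subst (_∣ n) (*-identityʳ p) p∣n)
  ... | yes (divides m n≡mp) = suc e , exact pᵉ⁺¹∣n pᵉ⁺²∤n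
    where
    m≢0 : m ≢ 0
    m≢0 refl = n≢0 n≡mp
    m<n : m < n
    m<n = subst (m <_) (sym n≡mp) (m<m*n m p {{≢-nonZero m≢0}} 1<p)
    e = proj₁ (rec m<n m≢0)
    pᵉ∣m = Exact.power∣ (proj₂ (rec m<n m≢0))
    pᵉ⁺¹∤m = Exact.nextPower∤ (proj₂ (rec m<n m≢0))
    pᵉ⁺¹∣n : p ^ suc e ∣ n
    pᵉ⁺¹∣n = subst₂ _∣_ (*-comm (p ^ e) p) (sym n≡mp) (*-monoˡ-∣ p pᵉ∣m)
    pᵉ⁺²∤n : ¬ (p ^ suc (suc e) ∣ n)
    pᵉ⁺²∤n pᵉ⁺²∣n = pᵉ⁺¹∤m (*-cancelʳ-∣ p {{>-nonZero (<-trans (s≤s z≤n) 1<p)}}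
                      (subst₂ _∣_ (*-comm p (p ^ suc e)) n≡mp pᵉ⁺²∣n))

exact? : ∀ p e n → Dec (Exact p e n)
exact? p e n = map′ (λ (a , b) → exact a b) (λ (exact a b) → a , b) ((p ^ e ∣? n) ×-dec ¬? (p ^ suc e ∣? n))

exactᵇ : ℕ → ℕ → ℕ → Bool
exactᵇ p m n = does (exact? p m n)

exactᵇ-periodic : ∀ p m D → p ^ suc m ∣ D → ∀ n → exactᵇ p m (n + D) ≡ exactᵇ p m n
exactᵇ-periodic p m D pᵐ⁺¹∣D n = T-injective
  (λ h → toDoes (exact? p m n) (remove (fromDoes (exact? p m (n + D)) h)))
  (λ h → toDoes (exact? p m (n + D)) (add (fromDoes (exact? p m n) h)))
  where
  pᵐ∣D : p ^ m ∣ D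
  pᵐ∣D = ∣-trans (m^n∣m^o p (n≤1+n m)) pᵐ⁺¹∣D
  remove : Exact p m (n + D) → Exact p m n
  remove (exact pᵐ∣n+D pᵐ⁺¹∤n+D) = exact (∣-+ʳ-cancel pᵐ∣D pᵐ∣n+D) λ pᵐ⁺¹∣n → pᵐ⁺¹∤n+D (∣m∣n⇒∣m+n pᵐ⁺¹∣n pᵐ⁺¹∣D)
  add : Exact p m n → Exact p m (n + D)
  add (exact pᵐ∣n pᵐ⁺¹∤n) = exact (∣m∣n⇒∣m+n pᵐ∣n pᵐ∣D) λ pᵐ⁺¹∣n+D → pᵐ⁺¹∤n (∣-+ʳ-cancel pᵐ⁺¹∣D pᵐ⁺¹∣n+D)

InTower⇒≢0 : ∀ {q n} → InTower q n → n ≢ 0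
InTower⇒≢0 (base n≢0 _ _) = n≢0
InTower⇒≢0 (expo n≢0 _ _ _ _) = n≢0

exact∧InTower⇒∣ : ∀ {q p e n} → Exact p e n → InTower q e → p ∣ n
exact∧InTower⇒∣ {e = zero} _ e∈M = ⊥-elim (InTower⇒≢0 e∈M refl)
exact∧InTower⇒∣ {p = p} {e = suc e} (exact pᵉ⁺¹∣n _) _ = ∣-trans (m∣m*n (p ^ e)) pᵉ⁺¹∣n

inTower? : ∀ {q} → Prime q → Decider q
inTower? {q} q-prime = <-rec (Dec ∘ InTower q) step
  where
  step : ∀ n → (∀ {m} → m < n → Dec (InTower q m)) → Dec (InTower q n)
  step zero _ = no (λ zero∈M → InTower⇒≢0 zero∈M refl)
  step n@(suc _) rec with q ∣? n
  ... | yes q∣n = yes (base (λ ()) q-prime q∣n)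
  ... | no q∤n = map′ sound complete (anyUpTo? witness? (suc n))
    where
    n≢0 : n ≢ 0
    n≢0 ()
    exponent? : ∀ p → Prime p → ∀ e → Dec (Exact p e n × InTower q e)
    exponent? p p-prime e with e <? n
    ... | yes e<n = exact? p e n ×-dec rec e<n
    ... | no e≮n = no (λ ((exact pᵉ∣n _) , _) → e≮n (exact⇒< (prime>1 p-prime) n≢0 pᵉ∣n))
    Witness : ℕ → Set
    Witness p = Prime p × ∃ λ e → e < n × (Exact p e n × InTower q e)
    witness? : ∀ p → Dec (Witness p)
    witness? p with prime? p
    ... | no ¬prime = no (¬prime ∘ proj₁)
    ... | yes p-prime = map′ (p-prime ,_) proj₂ (anyUpTo? (exponent? p p-prime) n)
    sound : (∃ λ p → p < suc n × Witness p) → InTower q n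
    sound (p , _ , p-prime , e , _ , exact pᵉ∣n pᵉ⁺¹∤n , e∈M) = expo n≢0 p-prime pᵉ∣n pᵉ⁺¹∤n e∈M
    complete : InTower q n → ∃ λ p → p < suc n × Witness p
    complete (base _ _ q∣n) = ⊥-elim (q∤n q∣n)
    complete (expo {p = p} {e = e} _ p-prime pᵉ∣n pᵉ⁺¹∤n e∈M) =
      p , s≤s (∣⇒≤ (exact∧InTower⇒∣ (exact pᵉ∣n pᵉ⁺¹∤n) e∈M)) , p-prime ,
      e , exact⇒< (prime>1 p-prime) n≢0 pᵉ∣n , exact pᵉ∣n pᵉ⁺¹∤n , e∈M

1∉M : ∀ {q} → ¬ InTower q 1
1∉M (base _ q-prime q∣1) = >1⇒∤1 (prime>1 q-prime) q∣1
1∉M (expo _ p-prime pᵉ∣1 pᵉ⁺¹∤1 e∈M) = >1⇒∤1 (prime>1 p-prime) (exact∧InTower⇒∣ (exact pᵉ∣1 pᵉ⁺¹∤1) e∈M)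

InTower⇒InTower-exactPower : ∀ {q n} → InTower q n →
                              ∃ λ p → ∃ λ v → Prime p × Exact p v n × InTower q (p ^ v)
InTower⇒InTower-exactPower {q} {n} (base n≢0 q-prime q∣n)
  with exactExponent (prime>1 q-prime) n n≢0
... | zero , exact _ q∤n = ⊥-elim (q∤n (subst (_∣ n) (sym (*-identityʳ q)) q∣n))
... | suc v , qᵛ⁺¹∥n = q , suc v , q-prime , qᵛ⁺¹∥n ,
                        base (1<m⇒m^n≢0 (prime>1 q-prime) (suc v)) q-prime (m∣m*n (q ^ v))
InTower⇒InTower-exactPower (expo {p = p} {e = e} _ p-prime pᵉ∣n pᵉ⁺¹∤n e∈M) =
  p , e , p-prime , exact pᵉ∣n pᵉ⁺¹∤n ,
  expo (1<m⇒m^n≢0 (prime>1 p-prime) e) p-prime ∣-refl (Exact.nextPower∤ (exact-^ (prime>1 p-prime) e)) e∈M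

InTower-exactPower⇒InTower : ∀ {q p v n} → n ≢ 0 → Prime p → Exact p v n →
                              InTower q (p ^ v) → InTower q n
InTower-exactPower⇒InTower n≢0 p-prime (exact pᵛ∣n _) (base _ q-prime q∣pᵛ) =
  base n≢0 q-prime (∣-trans q∣pᵛ pᵛ∣n)
InTower-exactPower⇒InTower {q} {p} {v} n≢0 p-prime pᵛ∥n (expo {p = r} {e = e} _ r-prime rᵉ∣pᵛ rᵉ⁺¹∤pᵛ e∈M) =
  expo n≢0 p-prime (Exact.power∣ pᵛ∥n) (Exact.nextPower∤ pᵛ∥n) (subst (InTower q) e≡v e∈M)
  where
  r≡p : r ≡ p
  r≡p = prime∣prime⇒≡ r-prime p-prime
          (prime∣m^n⇒prime∣m r-prime p v (exact∧InTower⇒∣ (exact rᵉ∣pᵛ rᵉ⁺¹∤pᵛ) e∈M))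
  e≡v : e ≡ v
  e≡v = exact-unique (subst (λ r → Exact r e (p ^ v)) r≡p (exact rᵉ∣pᵛ rᵉ⁺¹∤pᵛ)) (exact-^ (prime>1 p-prime) v)

prime∉M : ∀ {q p} → Prime p → p ≢ q → ¬ InTower q p
prime∉M p-prime p≢q (base _ q-prime q∣p) = p≢q (sym (prime∣prime⇒≡ q-prime p-prime q∣p))
prime∉M {q} {p} p-prime p≢q (expo {p = r} {e = e} _ r-prime rᵉ∣p rᵉ⁺¹∤p e∈M) =
  1∉M (subst (InTower q) e≡1 e∈M)
  where
  r≡p : r ≡ p
  r≡p = prime∣prime⇒≡ r-prime p-prime (exact∧InTower⇒∣ (exact rᵉ∣p rᵉ⁺¹∤p) e∈M)
  e≡1 : e ≡ 1
  e≡1 = exact-unique (subst (λ r → Exact r e p) r≡p (exact rᵉ∣p rᵉ⁺¹∤p))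
          (subst (Exact p 1) (*-identityʳ p) (exact-^ (prime>1 p-prime) 1))

m*n≤o⇒m≤o/n : ∀ m n o .{{_ : NonZero n}} → m * n ≤ o → m ≤ o / n
m*n≤o⇒m≤o/n m n o m*n≤o = subst (_≤ o / n) (m*n/n≡m m n) (/-monoˡ-≤ n m*n≤o)

X/[b+1]²+X/[b+1]≤X/b : ∀ X b .{{_ : NonZero b}} → X / (suc b * suc b) + X / suc b ≤ X / b
X/[b+1]²+X/[b+1]≤X/b X b = m*n≤o⇒m≤o/n (x + y) b X (begin
  (x + y) * b        ≡⟨ *-distribʳ-+ b x y ⟩
  x * b + y * b      ≤⟨ +-monoˡ-≤ (y * b) (≤-trans (*-monoʳ-≤ x (n≤1+n b)) x[b+1]≤y) ⟩
  y + y * b          ≡⟨ sym (*-suc y b) ⟩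
  y * suc b          ≤⟨ m/n*n≤m X (suc b) ⟩
  X                  ∎)
  where
  open ≤-Reasoning
  x = X / (suc b * suc b)
  y = X / suc b
  x[b+1]≤y : x * suc b ≤ y
  x[b+1]≤y = m*n≤o⇒m≤o/n (x * suc b) (suc b) X
    (subst (_≤ X) (sym (*-assoc x (suc b) (suc b))) (m/n*n≤m X (suc b * suc b)))

∑X/k²-telescope : ∀ X a m → ∑[ j < m ] (X / ((2 + a + j) * (2 + a + j))) + X / (suc a + m) ≤ X / suc a
∑X/k²-telescope X a zero = ≤-reflexive (cong (λ z → X / suc z) (+-identityʳ a))
∑X/k²-telescope X a (suc m) = begin
  X / ((2 + a + 0) * (2 + a + 0)) + ∑[ j < m ] (X / ((2 + a + suc j) * (2 + a + suc j))) + X / (suc a + suc m)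
    ≡⟨ cong₂ (λ u v → u + v + X / (suc a + suc m)) (cong (λ z → X / (suc z * suc z)) (+-identityʳ (suc a)))
         (∑<-cong m (λ j _ → cong (λ z → X / (suc z * suc z)) (+-suc (suc a) j))) ⟩
  X / ((2 + a) * (2 + a)) + ∑[ j < m ] (X / ((3 + a + j) * (3 + a + j))) + X / (suc a + suc m)
    ≡⟨ trans (+-assoc (X / ((2 + a) * (2 + a))) _ _)
             (cong (λ z → X / ((2 + a) * (2 + a)) + (∑[ j < m ] (X / ((3 + a + j) * (3 + a + j))) + X / suc z)) (+-suc a m)) ⟩
  X / ((2 + a) * (2 + a)) + (∑[ j < m ] (X / ((3 + a + j) * (3 + a + j))) + X / (2 + a + m))
    ≤⟨ +-monoʳ-≤ (X / ((2 + a) * (2 + a))) (∑X/k²-telescope X (suc a) m) ⟩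
  X / ((2 + a) * (2 + a)) + X / (2 + a) ≤⟨ X/[b+1]²+X/[b+1]≤X/b X (suc a) ⟩
  X / suc a ∎
  where open ≤-Reasoning

highPowerᵇ : ℕ → ℕ → ℕ → Bool
highPowerᵇ P₁ M₁ n = any< (suc P₁) (λ p → isPrimeᵇ p ∧ (p ^ suc M₁ ∣ᵇ n))

largeSquareᵇ : ℕ → ℕ → ℕ → Bool
largeSquareᵇ P₁ X n = any< X (λ j → (suc P₁ + j) * (suc P₁ + j) ∣ᵇ n)

exceptionalᵇ : ℕ → ℕ → ℕ → ℕ → Bool
exceptionalᵇ P₁ M₁ X n = highPowerᵇ P₁ M₁ n ∨ largeSquareᵇ P₁ X n

high-power⇒exceptional : ∀ {P₁ M₁ X n p} → Prime p → p ≤ P₁ → p ^ suc M₁ ∣ n →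
                         T (exceptionalᵇ P₁ M₁ X n)
high-power⇒exceptional {P₁} {M₁} {n = n} {p} p-prime p≤P₁ pᴹ⁺¹∣n = from T-∨ (inj₁
  (any<⁺ (λ p → isPrimeᵇ p ∧ (p ^ suc M₁ ∣ᵇ n)) (s≤s p≤P₁)
    (from T-∧ (toDoes (prime? p) p-prime , toDoes (p ^ suc M₁ ∣? n) pᴹ⁺¹∣n))))

large-square⇒exceptional : ∀ {P₁ M₁ X n k} → n ≢ 0 → n ≤ X → P₁ < k → k * k ∣ n →
                           T (exceptionalᵇ P₁ M₁ X n)
large-square⇒exceptional {P₁} {M₁} {X} {n} {k} n≢0 n≤X P₁<k k²∣n = from T-∨ (inj₂
  (any<⁺ (λ j → (suc P₁ + j) * (suc P₁ + j) ∣ᵇ n) j<X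
    (toDoes ((suc P₁ + j) * (suc P₁ + j) ∣? n) (subst (λ z → z * z ∣ n) (sym 1+P₁+j≡k) k²∣n))))
  where
  j = k ∸ suc P₁
  1+P₁+j≡k : suc P₁ + j ≡ k
  1+P₁+j≡k = m+[n∸m]≡n P₁<k
  k≤X : k ≤ X
  k≤X = ≤-trans (m≤m*n k k {{≢-nonZero (λ { refl → <⇒≱ P₁<k z≤n })}})
                (≤-trans (∣⇒≤ {{≢-nonZero n≢0}} k²∣n) n≤X)
  j<X : j < X
  j<X = <-≤-trans (subst (j <_) 1+P₁+j≡k (m<n+m j {suc P₁} (s≤s z≤n))) k≤X

count-highPowerᵇ : ∀ P₁ M₁ X →
  count (λ n → highPowerᵇ P₁ M₁ (suc n)) X ≤ suc P₁ * (X / 2 ^ suc M₁) {{m^n≢0 2 (suc M₁)}}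
count-highPowerᵇ P₁ M₁ X = begin
  count (λ n → highPowerᵇ P₁ M₁ (suc n)) X             ≤⟨ count-any<-≤ (suc P₁) _ X ⟩
  ∑[ p < suc P₁ ] count (multiple p) X                 ≤⟨ ∑<-mono-≤ (suc P₁) (λ p _ → each p) ⟩
  ∑[ p < suc P₁ ] (X / 2 ^ suc M₁) {{m^n≢0 2 (suc M₁)}}                     ≡⟨ ∑<-const (suc P₁) _ ⟩
  suc P₁ * (X / 2 ^ suc M₁) {{m^n≢0 2 (suc M₁)}}                            ∎
  where
  open ≤-Reasoning
  multiple : ℕ → ℕ → Bool
  multiple p n = isPrimeᵇ p ∧ (p ^ suc M₁ ∣ᵇ suc n)
  each : ∀ p → count (multiple p) X ≤ (X / 2 ^ suc M₁) {{m^n≢0 2 (suc M₁)}}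
  each p with prime? p
  ... | no _ = ≤-trans (≤-reflexive (trans (∑<-const X 0) (*-zeroʳ X))) z≤n
  ... | yes p-prime = begin
    count (λ n → p ^ suc M₁ ∣ᵇ suc n) X ≡⟨ count-multiples (p ^ suc M₁) X ⟩
    X / p ^ suc M₁                     ≤⟨ /-monoʳ-≤ X {{_}} {{m^n≢0 2 (suc M₁)}} (^-monoˡ-≤ (suc M₁) (prime>1 p-prime)) ⟩
    (X / 2 ^ suc M₁) {{m^n≢0 2 (suc M₁)}} ∎
    where
    instance
      pᴹ⁺¹≢0 : NonZero (p ^ suc M₁)
      pᴹ⁺¹≢0 = ≢-nonZero (1<m⇒m^n≢0 (prime>1 p-prime) (suc M₁))

count-largeSquareᵇ : ∀ a X → count (λ n → largeSquareᵇ (suc a) X (suc n)) X ≤ X / suc a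
count-largeSquareᵇ a X = begin
  count (λ n → largeSquareᵇ (suc a) X (suc n)) X                 ≤⟨ count-any<-≤ X _ X ⟩
  ∑[ j < X ] count (λ n → (2 + a + j) * (2 + a + j) ∣ᵇ suc n) X  ≡⟨ ∑<-cong X (λ j _ → count-multiples _ X) ⟩
  ∑[ j < X ] (X / ((2 + a + j) * (2 + a + j)))                   ≤⟨ m≤m+n _ _ ⟩
  ∑[ j < X ] (X / ((2 + a + j) * (2 + a + j))) + X / (suc a + X) ≤⟨ ∑X/k²-telescope X a X ⟩
  X / suc a                                                      ∎
  where open ≤-Reasoning

count-exceptionalᵇ : ∀ a M₁ X →
  count (λ n → exceptionalᵇ (suc a) M₁ X (suc n)) X ≤ (2 + a) * (X / 2 ^ suc M₁) {{m^n≢0 2 (suc M₁)}} + X / suc a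
count-exceptionalᵇ a M₁ X = ≤-trans (count-∨-≤ _ _ X)
  (+-mono-≤ (count-highPowerᵇ (suc a) M₁ X) (count-largeSquareᵇ a X))

toℚᵘ-/ : ∀ a d .{{_ : NonZero d}} → toℚᵘ (ℤ.+ a ℚ./ d) ℚᵘ.≃ mkℚᵘ (ℤ.+ a) (pred d)
toℚᵘ-/ a (suc d) = ℚ.toℚᵘ-fromℚᵘ (mkℚᵘ (ℤ.+ a) d)

a*d≡c*b⇒a/b≡c/d : ∀ a b c d .{{_ : NonZero b}} .{{_ : NonZero d}} → a * d ≡ c * b → ℤ.+ a ℚ./ b ≡ ℤ.+ c ℚ./ d
a*d≡c*b⇒a/b≡c/d a (suc b) c (suc d) ad≡cb = ℚ.toℚᵘ-injective
  (ℚᵘ.≃-trans (toℚᵘ-/ a (suc b)) (ℚᵘ.≃-trans (*≡* cross) (ℚᵘ.≃-sym (toℚᵘ-/ c (suc d)))))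
  where
  cross : ℤ.+ a ℤ.* ℤ.+ suc d ≡ ℤ.+ c ℤ.* ℤ.+ suc b
  cross = trans (sym (ℤ.pos-* a (suc d))) (trans (cong ℤ.+_ ad≡cb) (ℤ.pos-* c (suc b)))

a/b*c/d≡ac/bd : ∀ a b c d .{{_ : NonZero b}} .{{_ : NonZero d}} →
        ℤ.+ a ℚ./ b ℚ.* (ℤ.+ c ℚ./ d) ≡ (ℤ.+ (a * c) ℚ./ (b * d)) {{m*n≢0 b d}}
a/b*c/d≡ac/bd a (suc b) c (suc d) = ℚ.toℚᵘ-injective (ℚᵘ.≃-trans (ℚ.toℚᵘ-homo-* (ℤ.+ a ℚ./ suc b) (ℤ.+ c ℚ./ suc d))
  (ℚᵘ.≃-trans (ℚᵘ.*-cong (toℚᵘ-/ a (suc b)) (toℚᵘ-/ c (suc d)))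
    (ℚᵘ.≃-trans (ℚᵘ.≃-reflexive (cong (λ z → mkℚᵘ z _) (sym (ℤ.pos-* a c))))
      (ℚᵘ.≃-sym (toℚᵘ-/ (a * c) (suc b * suc d))))))

a/b+c/d≡[ad+cb]/bd : ∀ a b c d .{{_ : NonZero b}} .{{_ : NonZero d}} →
        ℤ.+ a ℚ./ b ℚ.+ ℤ.+ c ℚ./ d ≡ (ℤ.+ (a * d + c * b) ℚ./ (b * d)) {{m*n≢0 b d}}
a/b+c/d≡[ad+cb]/bd a (suc b) c (suc d) = ℚ.toℚᵘ-injective (ℚᵘ.≃-trans (ℚ.toℚᵘ-homo-+ (ℤ.+ a ℚ./ suc b) (ℤ.+ c ℚ./ suc d))
  (ℚᵘ.≃-trans (ℚᵘ.+-cong (toℚᵘ-/ a (suc b)) (toℚᵘ-/ c (suc d)))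
    (ℚᵘ.≃-trans (ℚᵘ.≃-reflexive (cong (λ z → mkℚᵘ z _) numerator))
      (ℚᵘ.≃-sym (toℚᵘ-/ (a * suc d + c * suc b) (suc b * suc d))))))
  where
  numerator : ℤ.+ a ℤ.* ℤ.+ suc d ℤ.+ ℤ.+ c ℤ.* ℤ.+ suc b ≡ ℤ.+ (a * suc d + c * suc b)
  numerator = trans (cong₂ ℤ._+_ (sym (ℤ.pos-* a (suc d))) (sym (ℤ.pos-* c (suc b))))
                    (sym (ℤ.pos-+ (a * suc d) (c * suc b)))

1-c/n≡s/n : ∀ s c n .{{_ : NonZero n}} → s + c ≡ n → 1ℚ - ℤ.+ c ℚ./ n ≡ ℤ.+ s ℚ./ n
1-c/n≡s/n s c n s+c≡n = begin
  1ℚ - ℤ.+ c ℚ./ n                          ≡⟨ cong (_- ℤ.+ c ℚ./ n) (sym sum≡1) ⟩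
  (ℤ.+ s ℚ./ n ℚ.+ ℤ.+ c ℚ./ n) - ℤ.+ c ℚ./ n   ≡⟨ //-rightDividesʳ (ℤ.+ c ℚ./ n) (ℤ.+ s ℚ./ n) ⟩
  ℤ.+ s ℚ./ n                               ∎
  where
  open ≡-Reasoning
  sum≡1 : ℤ.+ s ℚ./ n ℚ.+ ℤ.+ c ℚ./ n ≡ 1ℚ
  sum≡1 = trans (a/b+c/d≡[ad+cb]/bd s n c n) (a*d≡c*b⇒a/b≡c/d (s * n + c * n) (n * n) 1 1 {{m*n≢0 n n}} (begin
    (s * n + c * n) * 1 ≡⟨ *-identityʳ _ ⟩
    s * n + c * n       ≡⟨ sym (*-distribʳ-+ n s c) ⟩
    (s + c) * n         ≡⟨ cong (_* n) s+c≡n ⟩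
    n * n               ≡⟨ sym (*-identityˡ (n * n)) ⟩
    1 * (n * n)         ∎))

∣m⊖n∣≡∣m-n∣ : ∀ m n → ℤ.∣ m ⊖ n ∣ ≡ dist m n
∣m⊖n∣≡∣m-n∣ zero zero = refl
∣m⊖n∣≡∣m-n∣ zero (suc n) = refl
∣m⊖n∣≡∣m-n∣ (suc m) zero = refl
∣m⊖n∣≡∣m-n∣ (suc m) (suc n) = trans (cong ℤ.∣_∣ (ℤ.[1+m]⊖[1+n]≡m⊖n m n)) (∣m⊖n∣≡∣m-n∣ m n)

∣a/b-c/d∣≤ : ∀ a b c d .{{_ : NonZero b}} .{{_ : NonZero d}} n e .(cop : Coprime (suc n) (suc e)) →
         dist (a * d) (c * b) * suc e ≤ b * d → ∣ ℤ.+ a ℚ./ b - ℤ.+ c ℚ./ d ∣ ≤ℚ mkℚ +[1+ n ] e cop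
∣a/b-c/d∣≤ a (suc b) c (suc d) n e cop close = ℚ.toℚᵘ-cancel-≤ (ℚᵘ.≤-respˡ-≃ (ℚᵘ.≃-sym as-ℚᵘ) (*≤* cross))
  where
  x = ℤ.+ a ℚ./ suc b
  y = ℤ.+ c ℚ./ suc d
  as-ℚᵘ : toℚᵘ ∣ x - y ∣ ℚᵘ.≃ ℚᵘ.∣ mkℚᵘ (ℤ.+ a) b ℚᵘ.- mkℚᵘ (ℤ.+ c) d ∣
  as-ℚᵘ = ℚᵘ.≃-trans (ℚ.toℚᵘ-homo-∣-∣ (x - y)) (ℚᵘ.∣-∣-cong
    (ℚᵘ.≃-trans (ℚ.toℚᵘ-homo-+ x (ℚ.- y))
      (ℚᵘ.+-cong (toℚᵘ-/ a (suc b)) (ℚᵘ.≃-trans (ℚ.toℚᵘ-homo‿- y) (ℚᵘ.-‿cong (toℚᵘ-/ c (suc d)))))))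
  numerator : ℤ.+ a ℤ.* ℤ.+ suc d ℤ.+ (ℤ.- ℤ.+ c) ℤ.* ℤ.+ suc b ≡ (a * suc d) ⊖ (c * suc b)
  numerator = trans (cong₂ ℤ._+_ (sym (ℤ.pos-* a (suc d)))
                      (trans (sym (ℤ.neg-distribˡ-* (ℤ.+ c) (ℤ.+ suc b))) (cong ℤ.-_ (sym (ℤ.pos-* c (suc b))))))
                    (ℤ.m-n≡m⊖n (a * suc d) (c * suc b))
  δ = dist (a * suc d) (c * suc b)
  cross : ℤ.+ ℤ.∣ ℤ.+ a ℤ.* ℤ.+ suc d ℤ.+ (ℤ.- ℤ.+ c) ℤ.* ℤ.+ suc b ∣ ℤ.* ℤ.+ suc e ℤ.≤ +[1+ n ] ℤ.* ℤ.+ (suc b * suc d)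
  cross = subst₂ ℤ._≤_
    (trans (ℤ.pos-* δ (suc e)) (cong (λ z → ℤ.+ z ℤ.* ℤ.+ suc e) (sym (trans (cong ℤ.∣_∣ numerator) (∣m⊖n∣≡∣m-n∣ (a * suc d) (c * suc b))))))
    (ℤ.pos-* (suc n) (suc b * suc d))
    (ℤ.+≤+ (≤-trans close (m≤n*m (suc b * suc d) (suc n))))

module TowerDensity {q : ℕ} (q-prime : Prime q) (dec : Decider q) where

  outside : ℕ → Bool
  outside n = not (does (dec n))

  localᵇ : ℕ → ℕ → ℕ → Bool
  localᵇ p M n = any< (suc M) (λ m → exactᵇ p m n ∧ outside (p ^ m))

  localᵇ⁺ : ∀ {p M n m} → m ≤ M → Exact p m n → ¬ InTower q (p ^ m) → T (localᵇ p M n)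
  localᵇ⁺ {p} {M} {n} {m} m≤M pᵐ∥n pᵐ∉M =
    any<⁺ _ (s≤s m≤M) (from T-∧ (toDoes (exact? p m n) pᵐ∥n , toNotDoes (dec (p ^ m)) pᵐ∉M))

  localᵇ⁻ : ∀ {p M n} → T (localᵇ p M n) → ∃ λ m → m ≤ M × Exact p m n × ¬ InTower q (p ^ m)
  localᵇ⁻ {p} {M} {n} hit with any<⁻ _ hit
  ... | m , m<1+M , both with to T-∧ both
  ...   | pᵐ∥n , pᵐ∉M = m , ≤-pred m<1+M , fromDoes (exact? p m n) pᵐ∥n , fromNotDoes (dec (p ^ m)) pᵐ∉M

  factorᵇ : ℕ → ℕ → ℕ → Bool
  factorᵇ P M n = if isPrimeᵇ (suc P) then localᵇ (suc P) M n else true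

  truncatedᵇ : ℕ → ℕ → ℕ → Bool
  truncatedᵇ zero M n = true
  truncatedᵇ (suc P) M n = truncatedᵇ P M n ∧ factorᵇ P M n

  truncatedᵇ⁻ : ∀ P M n → T (truncatedᵇ P M n) → ∀ p → Prime p → p ≤ P → T (localᵇ p M n)
  truncatedᵇ⁻ zero M n _ p p-prime z≤n = ⊥-elim (<⇒≱ (prime>1 p-prime) z≤n)
  truncatedᵇ⁻ (suc P) M n hit p p-prime p≤1+P with to T-∧ hit | m≤n⇒m<n∨m≡n p≤1+P
  ... | below , _ | inj₁ p<1+P = truncatedᵇ⁻ P M n below p p-prime (≤-pred p<1+P)
  ... | _ , top | inj₂ refl with prime? (suc P)
  ...   | yes _ = top
  ...   | no not-prime = ⊥-elim (not-prime p-prime)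

  truncatedᵇ⁺ : ∀ P M n → (∀ p → Prime p → p ≤ P → T (localᵇ p M n)) → T (truncatedᵇ P M n)
  truncatedᵇ⁺ zero M n _ = _
  truncatedᵇ⁺ (suc P) M n all-local =
    from T-∧ (truncatedᵇ⁺ P M n (λ p p-prime p≤P → all-local p p-prime (m≤n⇒m≤1+n p≤P)) , top)
    where
    top : T (factorᵇ P M n)
    top with prime? (suc P)
    ... | yes 1+P-prime = all-local (suc P) 1+P-prime ≤-refl
    ... | no _ = _

  module Agreement (P₁ M₁ : ℕ) (q≤P₁ : q ≤ P₁) (1≤M₁ : 1 ≤ M₁) {n : ℕ} (n≢0 : n ≢ 0)
    (no-high-power : ∀ p → Prime p → p ≤ P₁ → ¬ (p ^ suc M₁ ∣ n))
    (no-large-square : ∀ k → P₁ < k → ¬ (k * k ∣ n)) where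

    small-exponent : ∀ {p v} → Prime p → p ≤ P₁ → Exact p v n → v ≤ M₁
    small-exponent {p} {v} p-prime p≤P₁ (exact pᵛ∣n _) with v ≤? M₁
    ... | yes v≤M₁ = v≤M₁
    ... | no v≰M₁ = ⊥-elim (no-high-power p p-prime p≤P₁ (∣-trans (m^n∣m^o p (≰⇒> v≰M₁)) pᵛ∣n))

    squarefree-exponent : ∀ {p v} → P₁ < p → Exact p v n → v ≤ 1
    squarefree-exponent {p} {v} P₁<p (exact pᵛ∣n _) with v ≤? 1
    ... | yes v≤1 = v≤1
    ... | no v≰1 = ⊥-elim (no-large-square p P₁<p (∣-trans p²∣pᵛ pᵛ∣n))
      where
      p²∣pᵛ : p * p ∣ p ^ v
      p²∣pᵛ = subst (_∣ p ^ v) (cong (p *_) (*-identityʳ p)) (m^n∣m^o p (≰⇒> v≰1))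

    outside⇒truncated : ∀ P M → M₁ ≤ M → T (outside n) → T (truncatedᵇ P M n)
    outside⇒truncated P M M₁≤M n∉M = truncatedᵇ⁺ P M n local
      where
      local : ∀ p → Prime p → p ≤ P → T (localᵇ p M n)
      local p p-prime _ with exactExponent (prime>1 p-prime) n n≢0
      ... | v , pᵛ∥n = localᵇ⁺ v≤M pᵛ∥n
                         (λ pᵛ∈M → fromNotDoes (dec n) n∉M (InTower-exactPower⇒InTower n≢0 p-prime pᵛ∥n pᵛ∈M))
        where
        v≤M : v ≤ M
        v≤M with p ≤? P₁
        ... | yes p≤P₁ = ≤-trans (small-exponent p-prime p≤P₁ pᵛ∥n) M₁≤M
        ... | no p≰P₁ = ≤-trans (squarefree-exponent (≰⇒> p≰P₁) pᵛ∥n) (≤-trans 1≤M₁ M₁≤M)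

    truncated⇒outside : ∀ P M → P₁ ≤ P → T (truncatedᵇ P M n) → T (outside n)
    truncated⇒outside P M P₁≤P all-local = toNotDoes (dec n) n∉M
      where
      n∉M : ¬ InTower q n
      n∉M n∈M with InTower⇒InTower-exactPower n∈M
      ... | p , v , p-prime , pᵛ∥n , pᵛ∈M with p ≤? P₁
      ...   | yes p≤P₁ with localᵇ⁻ {p} {M} (truncatedᵇ⁻ P M n all-local p p-prime (≤-trans p≤P₁ P₁≤P))
      ...     | m , _ , pᵐ∥n , pᵐ∉M = pᵐ∉M (subst (λ e → InTower q (p ^ e)) (exact-unique pᵛ∥n pᵐ∥n) pᵛ∈M)
      n∉M n∈M | p , v , p-prime , pᵛ∥n , pᵛ∈M | no p≰P₁
        with v | squarefree-exponent {p} {v} (≰⇒> p≰P₁) pᵛ∥n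
      ... | zero | _ = 1∉M pᵛ∈M
      ... | suc zero | _ with p ≟ q
      ...   | yes refl = p≰P₁ q≤P₁
      ...   | no p≢q = prime∉M p-prime p≢q (subst (InTower q) (*-identityʳ p) pᵛ∈M)
      n∉M n∈M | _ | no _ | suc (suc _) | s≤s ()

    outside≡truncated : ∀ P M → P₁ ≤ P → M₁ ≤ M → outside n ≡ truncatedᵇ P M n
    outside≡truncated P M P₁≤P M₁≤M =
      T-injective (outside⇒truncated P M M₁≤M) (truncated⇒outside P M P₁≤P)

  localᵇ-periodic : ∀ p M → Periodic (λ n → localᵇ p M (suc n)) (p ^ suc M)
  localᵇ-periodic p M n = any<-cong (suc M) (λ m m<1+M →
    cong (_∧ outside (p ^ m)) (exactᵇ-periodic p m (p ^ suc M) (m^n∣m^o p m<1+M) (suc n)))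

  -- ∑_{m ≤ M} p^(M−m) I(p^m), so that seriesPart is seriesNumerator / p^M.
  seriesNumerator : ℕ → ℕ → ℕ
  seriesNumerator p zero = 𝟙 (outside (p ^ 0))
  seriesNumerator p (suc M) = p * seriesNumerator p M + 𝟙 (outside (p ^ suc M))

  count-exactᵇ : ∀ {p} → 1 < p → ∀ m → count (λ n → exactᵇ p m (suc n)) (p ^ suc m) ≡ p ∸ 1
  count-exactᵇ {p} 1<p m = begin
    x                     ≡⟨ sym (m+n∸n≡m x 1) ⟩
    x + 1 ∸ 1             ≡⟨ cong (λ y → x + y ∸ 1) (sym exactly-one) ⟩
    x + count g pᵐ⁺¹ ∸ 1  ≡⟨ cong (_∸ 1) (count-∧-not f g pᵐ⁺¹ g⇒f) ⟩
    count f pᵐ⁺¹ ∸ 1      ≡⟨ cong (_∸ 1) (trans (count-multiples (p ^ m) {{pᵏ≢0 m}} pᵐ⁺¹) (m*n/n≡m p (p ^ m) {{pᵏ≢0 m}})) ⟩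
    p ∸ 1                 ∎
    where
    open ≡-Reasoning
    pᵏ≢0 : ∀ k → NonZero (p ^ k)
    pᵏ≢0 k = ≢-nonZero (1<m⇒m^n≢0 1<p k)
    pᵐ⁺¹ = p ^ suc m
    f g : ℕ → Bool
    f n = p ^ m ∣ᵇ suc n
    g n = p ^ suc m ∣ᵇ suc n
    x = count (λ n → exactᵇ p m (suc n)) pᵐ⁺¹
    exactly-one : count g pᵐ⁺¹ ≡ 1
    exactly-one = trans (count-multiples pᵐ⁺¹ {{pᵏ≢0 (suc m)}} pᵐ⁺¹) (n/n≡1 pᵐ⁺¹ {{pᵏ≢0 (suc m)}})
    g⇒f : ∀ n → T (g n) → T (f n)
    g⇒f n hit = toDoes (p ^ m ∣? suc n) (∣-trans (m^n∣m^o p (n≤1+n m)) (fromDoes (p ^ suc m ∣? suc n) hit))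

  count-localᵇ : ∀ {p} → Prime p → ∀ M →
                 count (λ n → localᵇ p M (suc n)) (p ^ suc M) ≡ (p ∸ 1) * seriesNumerator p M
  count-localᵇ {p} p-prime zero =
    trans (count-∧-const (λ n → exactᵇ p 0 (suc n)) (outside 1) (p ^ 1))
          (cong (_* 𝟙 (outside 1)) (count-exactᵇ (prime>1 p-prime) 0))
  count-localᵇ {p} p-prime (suc M) = begin
    count (λ n → localᵇ p M (suc n) ∨ top n) (p * p ^ suc M)
      ≡⟨ count-∨-disjoint _ top (p * p ^ suc M) disjoint ⟩
    count (λ n → localᵇ p M (suc n)) (p * p ^ suc M) + count top (p ^ suc (suc M))
      ≡⟨ cong₂ _+_ (count-period-multiple (localᵇ-periodic p M) p)
                   (count-∧-const (λ n → exactᵇ p (suc M) (suc n)) (outside (p ^ suc M)) (p ^ suc (suc M))) ⟩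
    p * count (λ n → localᵇ p M (suc n)) (p ^ suc M)
      + count (λ n → exactᵇ p (suc M) (suc n)) (p ^ suc (suc M)) * 𝟙 (outside (p ^ suc M))
      ≡⟨ cong₂ (λ a b → p * a + b * 𝟙 (outside (p ^ suc M)))
               (count-localᵇ p-prime M) (count-exactᵇ (prime>1 p-prime) (suc M)) ⟩
    p * ((p ∸ 1) * seriesNumerator p M) + (p ∸ 1) * 𝟙 (outside (p ^ suc M))
      ≡⟨ factor-out p (p ∸ 1) (seriesNumerator p M) (𝟙 (outside (p ^ suc M))) ⟩
    (p ∸ 1) * seriesNumerator p (suc M) ∎
    where
    open ≡-Reasoning
    top : ℕ → Bool
    top n = exactᵇ p (suc M) (suc n) ∧ outside (p ^ suc M)
    factor-out : ∀ p c a s → p * (c * a) + c * s ≡ c * (p * a + s)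
    factor-out = solve-∀
    disjoint : ∀ n → T (localᵇ p M (suc n)) → T (top n) → ⊥
    disjoint n low high with localᵇ⁻ {p} {M} low
    ... | m , m≤M , pᵐ∥n , _ = <⇒≢ (s≤s m≤M)
            (sym (exact-unique (fromDoes (exact? p (suc M) (suc n)) (proj₁ (to T-∧ high))) pᵐ∥n))

  periodFactor : ℕ → ℕ → ℕ
  periodFactor P M = if isPrimeᵇ (suc P) then suc P ^ suc M else 1

  countFactor : ℕ → ℕ → ℕ
  countFactor P M = if isPrimeᵇ (suc P) then (suc P ∸ 1) * seriesNumerator (suc P) M else 1

  period : ℕ → ℕ → ℕ
  period zero M = 1
  period (suc P) M = periodFactor P M * period P M

  periodCount : ℕ → ℕ → ℕ
  periodCount P M = count (λ n → truncatedᵇ P M (suc n)) (period P M)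

  periodFactor≢0 : ∀ P M → NonZero (periodFactor P M)
  periodFactor≢0 P M with prime? (suc P)
  ... | yes p-prime = ≢-nonZero (1<m⇒m^n≢0 (prime>1 p-prime) (suc M))
  ... | no _ = _

  period≢0 : ∀ P M → NonZero (period P M)
  period≢0 zero M = _
  period≢0 (suc P) M = m*n≢0 (periodFactor P M) (period P M) {{periodFactor≢0 P M}} {{period≢0 P M}}

  factorᵇ-periodic : ∀ P M → Periodic (λ n → factorᵇ P M (suc n)) (periodFactor P M)
  factorᵇ-periodic P M with prime? (suc P)
  ... | yes _ = localᵇ-periodic (suc P) M
  ... | no _ = λ _ → refl

  truncatedᵇ-periodic : ∀ P M → Periodic (λ n → truncatedᵇ P M (suc n)) (period P M)
  truncatedᵇ-periodic zero M _ = refl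
  truncatedᵇ-periodic (suc P) M = periodic-∧
    (periodic-*ˡ (truncatedᵇ-periodic P M) (periodFactor P M))
    (periodic-*ʳ (factorᵇ-periodic P M) (period P M))

  prime∤period : ∀ {r} → Prime r → ∀ P M → P < r → ¬ r ∣ period P M
  prime∤period r-prime zero M _ r∣1 = >1⇒∤1 (prime>1 r-prime) r∣1
  prime∤period r-prime (suc P) M P<r r∣period with euclidsLemma (periodFactor P M) (period P M) r-prime r∣period
  ... | inj₂ r∣rest = prime∤period r-prime P M (<-trans (n<1+n P) P<r) r∣rest
  ... | inj₁ r∣factor with prime? (suc P)
  ...   | yes _ = <⇒≱ P<r (∣⇒≤ (prime∣m^n⇒prime∣m r-prime (suc P) (suc M) r∣factor))
  ...   | no _ = >1⇒∤1 (prime>1 r-prime) r∣factor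

  periodCount-suc : ∀ P M → periodCount (suc P) M ≡ periodCount P M * countFactor P M
  periodCount-suc P M with prime? (suc P)
  ... | yes p-prime =
    trans (count-∧-coprime (period P M) (suc P ^ suc M) {{≢-nonZero (1<m⇒m^n≢0 (prime>1 p-prime) (suc M))}} (truncatedᵇ-periodic P M) (localᵇ-periodic (suc P) M)
             (prime∤⇒coprime-^ p-prime (prime∤period p-prime P M ≤-refl) (suc M)))
          (cong (periodCount P M *_) (count-localᵇ p-prime M))
  ... | no _ = begin
    count (λ n → truncatedᵇ P M (suc n) ∧ true) (period P M + 0)
      ≡⟨ cong (count _) (+-identityʳ (period P M)) ⟩
    count (λ n → truncatedᵇ P M (suc n) ∧ true) (period P M)
      ≡⟨ count-∧-const (λ n → truncatedᵇ P M (suc n)) true (period P M) ⟩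
    periodCount P M * 1 ∎
    where open ≡-Reasoning

  outsideCount : ℕ → ℕ
  outsideCount N = count (λ n → outside (suc n)) N

  truncatedCount : ℕ → ℕ → ℕ → ℕ
  truncatedCount P M X = count (λ n → truncatedᵇ P M (suc n)) X

  module Estimate (a M₁ : ℕ) (q≤1+a : q ≤ suc a) (1≤M₁ : 1 ≤ M₁) where

    exceptional : ℕ → ℕ → Bool
    exceptional X n = exceptionalᵇ (suc a) M₁ X (suc n)

    outside≡truncated-unless-exceptional : ∀ X n → n < X → ¬ T (exceptional X n) →
      ∀ P M → suc a ≤ P → M₁ ≤ M → outside (suc n) ≡ truncatedᵇ P M (suc n)
    outside≡truncated-unless-exceptional X n n<X ordinary =
      Agreement.outside≡truncated (suc a) M₁ q≤1+a 1≤M₁ (λ ())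
        (λ p p-prime p≤P₁ pᴹ⁺¹∣n → ordinary (high-power⇒exceptional {suc a} {M₁} {X} p-prime p≤P₁ pᴹ⁺¹∣n))
        (λ k P₁<k k²∣n → ordinary (large-square⇒exceptional {suc a} {M₁} {X} (λ ()) n<X P₁<k k²∣n))

    dist-outside-truncated₁ : ∀ N → dist (outsideCount N) (truncatedCount (suc a) M₁ N) ≤ count (exceptional N) N
    dist-outside-truncated₁ N = dist-count-≤ _ _ (exceptional N) N
      (λ n n<N ordinary → outside≡truncated-unless-exceptional N n n<N ordinary (suc a) M₁ ≤-refl ≤-refl)

    dist-truncated-truncated₁ : ∀ P M → suc a ≤ P → M₁ ≤ M → ∀ X →
      dist (truncatedCount P M X) (truncatedCount (suc a) M₁ X) ≤ count (exceptional X) X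
    dist-truncated-truncated₁ P M P₁≤P M₁≤M X = dist-count-≤ _ _ (exceptional X) X
      (λ n n<X ordinary → trans (sym (outside≡truncated-unless-exceptional X n n<X ordinary P M P₁≤P M₁≤M))
                                (outside≡truncated-unless-exceptional X n n<X ordinary (suc a) M₁ ≤-refl ≤-refl))

    D₁ C₁ : ℕ
    D₁ = period (suc a) M₁
    C₁ = periodCount (suc a) M₁

    dist-periodCounts : ∀ P M → suc a ≤ P → M₁ ≤ M →
      dist (period P M * C₁) (D₁ * periodCount P M) ≤ count (exceptional (period P M * D₁)) (period P M * D₁)
    dist-periodCounts P M P₁≤P M₁≤M = begin
      dist (D * C₁) (D₁ * periodCount P M)
        ≡⟨ cong₂ dist (sym (count-period-multiple (truncatedᵇ-periodic (suc a) M₁) D))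
                      (sym (trans (cong (truncatedCount P M) (*-comm D D₁))
                                  (count-period-multiple (truncatedᵇ-periodic P M) D₁))) ⟩
      dist (truncatedCount (suc a) M₁ X) (truncatedCount P M X)
        ≡⟨ ∣-∣-comm (truncatedCount (suc a) M₁ X) (truncatedCount P M X) ⟩
      dist (truncatedCount P M X) (truncatedCount (suc a) M₁ X)
        ≤⟨ dist-truncated-truncated₁ P M P₁≤P M₁≤M X ⟩
      count (exceptional X) X ∎
      where
      open ≤-Reasoning
      D = period P M
      X = D * D₁

    -- s/N ≈ t₁/N off the exceptional set, t₁/N ≈ C₁/D₁ by periodicity, and
    -- C₁/D₁ ≈ C/D by comparing both truncations over the common period D·D₁.
    scaled-estimate : ∀ P M N → suc a ≤ P → M₁ ≤ M →
      D₁ * dist (outsideCount N * period P M) (periodCount P M * N) ≤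
      D₁ * period P M * count (exceptional N) N + (period P M * (D₁ * D₁)
        + N * count (exceptional (period P M * D₁)) (period P M * D₁))
    scaled-estimate P M N P₁≤P M₁≤M = begin
      D₁ * dist (s * D) (C * N)
        ≡⟨ *-distribˡ-∣-∣ D₁ (s * D) (C * N) ⟩
      dist (D₁ * (s * D)) (D₁ * (C * N))
        ≡⟨ cong₂ dist (shuffle₁ D₁ s D) (shuffle₂ D₁ C N) ⟩
      dist (D₁ * D * s) (N * (D₁ * C))
        ≤⟨ ∣-∣-triangle (D₁ * D * s) (D₁ * D * t₁) _ ⟩
      dist (D₁ * D * s) (D₁ * D * t₁) + dist (D₁ * D * t₁) (N * (D₁ * C))
        ≤⟨ +-monoʳ-≤ (dist (D₁ * D * s) (D₁ * D * t₁)) (∣-∣-triangle (D₁ * D * t₁) (N * (D * C₁)) _) ⟩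
      dist (D₁ * D * s) (D₁ * D * t₁) + (dist (D₁ * D * t₁) (N * (D * C₁)) + dist (N * (D * C₁)) (N * (D₁ * C)))
        ≡⟨ cong₂ _+_ (sym (*-distribˡ-∣-∣ (D₁ * D) s t₁))
             (cong₂ _+_ (trans (cong₂ dist (shuffle₃ D₁ D t₁) (shuffle₄ N D C₁)) (sym (*-distribˡ-∣-∣ D (t₁ * D₁) (C₁ * N))))
                        (sym (*-distribˡ-∣-∣ N (D * C₁) (D₁ * C)))) ⟩
      D₁ * D * dist s t₁ + (D * dist (t₁ * D₁) (C₁ * N) + N * dist (D * C₁) (D₁ * C))
        ≤⟨ +-mono-≤ (*-monoʳ-≤ (D₁ * D) (dist-outside-truncated₁ N))
             (+-mono-≤ (*-monoʳ-≤ D (dist-count-periodic (truncatedᵇ-periodic (suc a) M₁) {{period≢0 (suc a) M₁}} N))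
                       (*-monoʳ-≤ N (dist-periodCounts P M P₁≤P M₁≤M))) ⟩
      D₁ * D * count (exceptional N) N + (D * (D₁ * D₁) + N * count (exceptional X) X) ∎
      where
      open ≤-Reasoning
      D = period P M
      C = periodCount P M
      s = outsideCount N
      t₁ = truncatedCount (suc a) M₁ N
      X = D * D₁
      shuffle₁ : ∀ d s D → d * (s * D) ≡ d * D * s
      shuffle₁ = solve-∀
      shuffle₂ : ∀ d C N → d * (C * N) ≡ N * (d * C)
      shuffle₂ = solve-∀
      shuffle₃ : ∀ d D t → d * D * t ≡ D * (t * d)
      shuffle₃ = solve-∀
      shuffle₄ : ∀ N D c → N * (D * c) ≡ D * (c * N)
      shuffle₄ = solve-∀

    module _ (K : ℕ) (8K≤a : 8 * K ≤ a) (8K[2+a]≤2ᴹ¹⁺¹ : 8 * K * (2 + a) ≤ 2 ^ suc M₁) where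

      exceptional-rare : ∀ Y → 4 * K * count (exceptional Y) Y ≤ Y
      exceptional-rare Y = *-cancelˡ-≤ 2 (begin
        2 * (4 * K * e)                   ≡⟨ regroup K e ⟩
        8 * K * e                         ≤⟨ *-monoʳ-≤ (8 * K) (count-exceptionalᵇ a M₁ Y) ⟩
        8 * K * ((2 + a) * y₁ + y₂)       ≡⟨ expand (8 * K) (2 + a) y₁ y₂ ⟩
        8 * K * (2 + a) * y₁ + 8 * K * y₂ ≤⟨ +-mono-≤ high-powers large-squares ⟩
        Y + Y                             ≡⟨ cong (Y +_) (sym (+-identityʳ Y)) ⟩
        2 * Y                             ∎)
        where
        open ≤-Reasoning
        e = count (exceptional Y) Y
        y₁ = (Y / 2 ^ suc M₁) {{m^n≢0 2 (suc M₁)}}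
        y₂ = Y / suc a
        regroup : ∀ K e → 2 * (4 * K * e) ≡ 8 * K * e
        regroup = solve-∀
        expand : ∀ k b y z → k * (b * y + z) ≡ k * b * y + k * z
        expand = solve-∀
        high-powers : 8 * K * (2 + a) * y₁ ≤ Y
        high-powers = ≤-trans (*-monoˡ-≤ y₁ 8K[2+a]≤2ᴹ¹⁺¹)
          (≤-trans (≤-reflexive (*-comm (2 ^ suc M₁) y₁)) (m/n*n≤m Y (2 ^ suc M₁) {{m^n≢0 2 (suc M₁)}}))
        large-squares : 8 * K * y₂ ≤ Y
        large-squares = ≤-trans (*-monoˡ-≤ y₂ (≤-trans 8K≤a (n≤1+n a)))
          (≤-trans (≤-reflexive (*-comm (suc a) y₂)) (m/n*n≤m Y (suc a)))

      approximation : ∀ P M N → suc a ≤ P → M₁ ≤ M → 2 * K * D₁ ≤ N →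
        dist (outsideCount N * period P M) (periodCount P M * N) * K ≤ N * period P M
      approximation P M N P₁≤P M₁≤M 2KD₁≤N = *-cancelˡ-≤ D₁ {{period≢0 (suc a) M₁}} (begin
        D₁ * (δ * K)   ≡⟨ swap D₁ δ K ⟩
        K * (D₁ * δ)   ≤⟨ *-monoʳ-≤ K (scaled-estimate P M N P₁≤P M₁≤M) ⟩
        K * E          ≤⟨ K*E≤ ⟩
        D₁ * (N * D)   ∎)
        where
        open ≤-Reasoning
        D = period P M
        X = D * D₁
        δ = dist (outsideCount N * D) (periodCount P M * N)
        eN = count (exceptional N) N
        eX = count (exceptional X) X
        E = D₁ * D * eN + (D * (D₁ * D₁) + N * eX)
        swap : ∀ d δ K → d * (δ * K) ≡ K * (d * δ)
        swap = solve-∀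
        expand : ∀ K d D eN N eX →
          4 * (K * (d * D * eN + (D * (d * d) + N * eX))) ≡
          d * D * (4 * K * eN) + 2 * D * d * (2 * K * d) + N * (4 * K * eX)
        expand = solve-∀
        collect : ∀ d D N → d * D * N + 2 * D * d * N + N * (D * d) ≡ 4 * (d * (N * D))
        collect = solve-∀
        K*E≤ : K * E ≤ D₁ * (N * D)
        K*E≤ = *-cancelˡ-≤ 4 (begin
          4 * (K * E)   ≡⟨ expand K D₁ D eN N eX ⟩
          D₁ * D * (4 * K * eN) + 2 * D * D₁ * (2 * K * D₁) + N * (4 * K * eX)
            ≤⟨ +-mono-≤ (+-mono-≤ (*-monoʳ-≤ (D₁ * D) (exceptional-rare N)) (*-monoʳ-≤ (2 * D * D₁) 2KD₁≤N))
                        (*-monoʳ-≤ N (exceptional-rare X)) ⟩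
          D₁ * D * N + 2 * D * D₁ * N + N * X ≡⟨ collect D₁ D N ⟩
          4 * (D₁ * (N * D)) ∎)

  seriesTerm≡ : ∀ k m → seriesTerm dec k m ≡ (ℤ.+ 𝟙 (outside (suc k ^ m)) ℚ./ suc k ^ m) {{m^n≢0 (suc k) m}}
  seriesTerm≡ k m with does (dec (suc k ^ m))
  ... | true = a*d≡c*b⇒a/b≡c/d 0 1 0 (suc k ^ m) {{_}} {{m^n≢0 (suc k) m}} refl
  ... | false = refl

  seriesPart≡ : ∀ k M → seriesPart dec k M ≡ (ℤ.+ seriesNumerator (suc k) M ℚ./ suc k ^ M) {{m^n≢0 (suc k) M}}
  seriesPart≡ k zero = seriesTerm≡ k zero
  seriesPart≡ k (suc M) = begin
    seriesPart dec k M ℚ.+ seriesTerm dec k (suc M)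
      ≡⟨ cong₂ ℚ._+_ (seriesPart≡ k M) (seriesTerm≡ k (suc M)) ⟩
    ℤ.+ A ℚ./ pᴹ ℚ.+ ℤ.+ t ℚ./ (p * pᴹ)
      ≡⟨ a/b+c/d≡[ad+cb]/bd A pᴹ t (p * pᴹ) ⟩
    (ℤ.+ (A * (p * pᴹ) + t * pᴹ) ℚ./ (pᴹ * (p * pᴹ))) {{m*n≢0 pᴹ (p * pᴹ)}}
      ≡⟨ a*d≡c*b⇒a/b≡c/d (A * (p * pᴹ) + t * pᴹ) (pᴹ * (p * pᴹ)) (p * A + t) (p * pᴹ) {{m*n≢0 pᴹ (p * pᴹ)}}
           (common-factor A pᴹ p t) ⟩
    ℤ.+ (p * A + t) ℚ./ (p * pᴹ) ∎
    where
    open ≡-Reasoning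
    p = suc k
    pᴹ = p ^ M
    A = seriesNumerator p M
    t = 𝟙 (outside (p ^ suc M))
    instance
      pᴹ≢0 : NonZero pᴹ
      pᴹ≢0 = m^n≢0 p M
      pᴹ⁺¹≢0 : NonZero (p * pᴹ)
      pᴹ⁺¹≢0 = m^n≢0 p (suc M)
    common-factor : ∀ A x p t → (A * (p * x) + t * x) * (p * x) ≡ (p * A + t) * (x * (p * x))
    common-factor = solve-∀

  factor≡ : ∀ P M → factor dec M P ≡ (ℤ.+ countFactor P M ℚ./ periodFactor P M) {{periodFactor≢0 P M}}
  factor≡ P M with prime? (suc P)
  ... | no _ = refl
  ... | yes _ = begin
    (1ℚ ℚ.- ℤ.+ 1 ℚ./ p) ℚ.* seriesPart dec P M
      ≡⟨ cong₂ ℚ._*_ (1-c/n≡s/n (p ∸ 1) 1 p (+-comm (p ∸ 1) 1)) (seriesPart≡ P M) ⟩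
    ℤ.+ (p ∸ 1) ℚ./ p ℚ.* (ℤ.+ seriesNumerator p M ℚ./ p ^ M) {{m^n≢0 p M}}
      ≡⟨ a/b*c/d≡ac/bd (p ∸ 1) p (seriesNumerator p M) (p ^ M) {{_}} {{m^n≢0 p M}} ⟩
    (ℤ.+ ((p ∸ 1) * seriesNumerator p M) ℚ./ p ^ suc M) {{m^n≢0 p (suc M)}} ∎
    where
    open ≡-Reasoning
    p = suc P

  partialProd≡ : ∀ P M → partialProd dec P M ≡ (ℤ.+ periodCount P M ℚ./ period P M) {{period≢0 P M}}
  partialProd≡ zero M = refl
  partialProd≡ (suc P) M = begin
    factor dec M P ℚ.* partialProd dec P M
      ≡⟨ cong₂ ℚ._*_ (factor≡ P M) (partialProd≡ P M) ⟩
    (ℤ.+ countFactor P M ℚ./ periodFactor P M) {{periodFactor≢0 P M}} ℚ.* (ℤ.+ periodCount P M ℚ./ period P M) {{period≢0 P M}}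
      ≡⟨ a/b*c/d≡ac/bd (countFactor P M) (periodFactor P M) (periodCount P M) (period P M) {{periodFactor≢0 P M}} {{period≢0 P M}} ⟩
    (ℤ.+ (countFactor P M * periodCount P M) ℚ./ period (suc P) M) {{period≢0 (suc P) M}}
      ≡⟨ cong (λ c → (ℤ.+ c ℚ./ period (suc P) M) {{period≢0 (suc P) M}})
              (trans (*-comm (countFactor P M) (periodCount P M)) (sym (periodCount-suc P M))) ⟩
    (ℤ.+ periodCount (suc P) M ℚ./ period (suc P) M) {{period≢0 (suc P) M}} ∎
    where open ≡-Reasoning

  outsideCount+countM : ∀ X → outsideCount X + countM dec X ≡ X
  outsideCount+countM zero = refl
  outsideCount+countM (suc X) = begin
    outsideCount (suc X) + (𝟙 (does (dec (suc X))) + countM dec X)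
      ≡⟨ cong (_+ (𝟙 (does (dec (suc X))) + countM dec X)) (∑<-suc X _) ⟩
    outsideCount X + 𝟙 (outside (suc X)) + (𝟙 (does (dec (suc X))) + countM dec X)
      ≡⟨ regroup (outsideCount X) (𝟙 (outside (suc X))) _ (countM dec X) ⟩
    (𝟙 (outside (suc X)) + 𝟙 (does (dec (suc X)))) + (outsideCount X + countM dec X)
      ≡⟨ cong₂ _+_ (𝟙-not+𝟙 (does (dec (suc X)))) (outsideCount+countM X) ⟩
    suc X ∎
    where
    open ≡-Reasoning
    regroup : ∀ a b c d → a + b + (c + d) ≡ (b + c) + (a + d)
    regroup = solve-∀
    𝟙-not+𝟙 : ∀ x → 𝟙 (not x) + 𝟙 x ≡ 1
    𝟙-not+𝟙 true = refl
    𝟙-not+𝟙 false = refl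

  complDensity≡ : ∀ N → complDensity dec N ≡ ℤ.+ outsideCount (suc N) ℚ./ suc N
  complDensity≡ N = 1-c/n≡s/n (outsideCount (suc N)) (countM dec (suc N)) (suc N) (outsideCount+countM (suc N))

  density≈partialProduct : ∀ ε → Positive ε →
    ∃[ N₀ ] ∃[ P₀ ] ((N P : ℕ) → N₀ ≤ N → P₀ ≤ P →
      ∃[ M₀ ] ((M : ℕ) → M₀ ≤ M → ∣ complDensity dec N - partialProd dec P M ∣ ≤ℚ ε))
  density≈partialProduct (mkℚ +[1+ n ] e cop) _ = N₀ , suc a , λ N P N₀≤N P₁≤P → M₁ , λ M M₁≤M →
    subst₂ (λ x y → ∣ x - y ∣ ≤ℚ mkℚ +[1+ n ] e cop) (sym (complDensity≡ N)) (sym (partialProd≡ P M))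
      (∣a/b-c/d∣≤ (outsideCount (suc N)) (suc N) (periodCount P M) (period P M) {{_}} {{period≢0 P M}} n e cop
        (Estimate.approximation a M₁ q≤1+a (s≤s z≤n) K (m≤n+m (8 * K) q) 8K[2+a]≤2ᴹ¹⁺¹
          P M (suc N) P₁≤P M₁≤M (≤-trans N₀≤N (n≤1+n N))))
    where
    -- ε ≥ 1/K.  P₁ = a + 1 ≥ 8K and 2^(M₁+1) ≥ 8K(P₁ + 1) make the exceptional
    -- integers up to Y number at most Y/(4K).
    K = suc e
    a = q + 8 * K
    M₁ = 8 * K * (2 + a)
    N₀ = 2 * K * period (suc a) M₁
    q≤1+a : q ≤ suc a
    q≤1+a = ≤-trans (m≤m+n q (8 * K)) (n≤1+n a)
    8K[2+a]≤2ᴹ¹⁺¹ : M₁ ≤ 2 ^ suc M₁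
    8K[2+a]≤2ᴹ¹⁺¹ = ≤-trans (<⇒≤ (n<m^n {2} (s≤s (s≤s z≤n)) M₁)) (^-monoʳ-≤ 2 (n≤1+n M₁))
  density≈partialProduct (mkℚ +0 _ _) ε>0 = ⊥-elim (ℤ.Positive.pos ε>0)
  density≈partialProduct (mkℚ ℤ.-[1+ _ ] _ _) ε>0 = ⊥-elim (ℤ.Positive.pos ε>0)

proposition2 : (q : ℕ) → Prime q →
    Decider q ×
    ((dec : Decider q) → (ε : ℚ) → Positive ε →
      ∃[ N₀ ] ∃[ P₀ ] ((N P : ℕ) → N₀ ≤ N → P₀ ≤ P →
        ∃[ M₀ ] ((M : ℕ) → M₀ ≤ M →
          ∣ complDensity dec N - partialProd dec P M ∣ ≤ℚ ε)))
proposition2 q q-prime = inTower? q-prime , λ dec → TowerDensity.density≈partialProduct q-prime dec
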